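{- Let $p$ be a prime, $q=p^t\ge 4$, $n\ge 2$, and let $\mathcal{D}$ be an affine resolvable $2$-$(q^n,q^{n-1},(q^{n-1}-1)/(q-1))$ design. If $\mathcal{D}$ is linearly embeddable over $GF(p)$ as a residual design with respect to a normal block in a symmetric $2$-$((q^{n+1}-1)/(q-1),(q^n-1)/(q-1),(q^{n-1}-1)/(q-1))$ design, then the linear code over $GF(p)$ spanned by the rows of the point-by-block incidence matrix of $\mathcal{D}$ contains at least $(p-1)\binom{(q^n-1)/(q-1)}{2}$ codewords of weight $2q^{n-1}$ whose supports (as sets of blocks of $\mathcal{D}$) are unions of parallel classes of $\mathcal{D}$.
   Context: A $2$-$(v,k,\lambda)$ design has $v$ points, blocks of size $k$, each pair of points in $\lambda$ blocks; symmetric means $v$ blocks; affine resolvable means its blocks partition into parallel classes (pairwise disjoint blocks covering all points) and any two non-parallel blocks meet in a constant number of points; such a design has a unique resolution into parallel classes. For a block $B$ of a design $\mathcal{D}_1=(X,\mathcal{B})$, the residual design $(\mathcal{D}_1)_B$ has point set $X\setminus B$ and blocks $B_j\setminus B$, $B_j\ne B$, and the derived design has point set $B$ and blocks $B\cap B_j$, $B_j\ne B$. $\mathcal{D}$ is linearly embeddable over $GF(p)$ as a residual design in $\mathcal{D}_1$ with respect to $B$ if $(\mathcal{D}_1)_B\cong\mathcal{D}$ and $\mathrm{rank}_p A_1=\mathrm{rank}_p A+1$, where $A_1,A$ are the incidence matrices of $\mathcal{D}_1,\mathcal{D}$. A block $B$ of the symmetric design $\mathcal{D}_1$ is normal if its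 derived design is the union of $q$ identical copies of the block set of a symmetric $2$-$((q^n-1)/(q-1),(q^{n-1}-1)/(q-1),(q^{n-2}-1)/(q-1))$ design. -}

module Defs where

open import Data.Nat using (ℕ; zero; suc; _+_; _*_; _∸_; _^_; _%_; _/_; _≡ᵇ_)
open import Data.Bool using (Bool; true; false; if_then_else_; _∧_; not)
open import Data.Fin using (Fin; zero; suc; toℕ)
open import Data.Product using (Σ; ∃; _×_; _,_)
open import Relation.Binary.PropositionalEquality using (_≡_; _≢_)
open import Relation.Nullary using (¬_)
open import Function.Definitions using (Injective)

_≡ᶠ_ : ∀ {n} → Fin n → Fin n → Bool
i ≡ᶠ j = toℕ i ≡ᵇ toℕ j

χ : Bool → ℕ
χ true  = 1
χ false = 0

count : ∀ {n} → (Fin n → Bool) → ℕ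
count {zero}  f = 0
count {suc n} f = χ (f zero) + count (λ i → f (suc i))

sumFin : ∀ {n} → (Fin n → ℕ) → ℕ
sumFin {zero}  f = 0
sumFin {suc n} f = f zero + sumFin (λ i → f (suc i))

-- total versions of mod and div (the divisor is nonzero wherever used)
_mod_ : ℕ → ℕ → ℕ
a mod zero  = a
a mod suc d = a % suc d

_div_ : ℕ → ℕ → ℕ
a div zero  = 0
a div suc d = a / suc d

θ : ℕ → ℕ → ℕ
θ q m = (q ^ m ∸ 1) div (q ∸ 1)

-- A design with v points and b blocks is given by its point-by-block incidence
-- matrix N (N x j = true iff point x lies in block j); repeated blocks allowed.
Is2Design : (v b k lam : ℕ) → (Fin v → Fin b → Bool) → Set
Is2Design v b k lam N =
  (∀ j → count (λ x → N x j) ≡ k) ×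
  (∀ x y → x ≢ y → count (λ j → N x j ∧ N y j) ≡ lam)

IsSymmetric2Design : (v k lam : ℕ) → (Fin v → Fin v → Bool) → Set
IsSymmetric2Design v k lam N = Is2Design v v k lam N

-- c assigns each block a class index; each class is a parallel class
-- (every point lies in exactly one block of the class), and any two
-- non-parallel blocks meet in a constant number μ of points.
IsAffineResolution : ∀ {v b m} → (Fin v → Fin b → Bool) → (Fin b → Fin m) → Set
IsAffineResolution {v} {b} {m} N c =
  (∀ (i : Fin m) (x : Fin v) → count (λ j → N x j ∧ (c j ≡ᶠ i)) ≡ 1) ×
  (Σ ℕ λ μ → ∀ j j' → c j ≢ c j' → count (λ x → N x j ∧ N x j') ≡ μ)

RowsIndependent : (p : ℕ) → ∀ {m b r} → (Fin m → Fin b → Bool) → (Fin r → Fin m) → Set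
RowsIndependent p {m} {b} {r} N rows =
  ∀ (a : Fin r → ℕ) →
    (∀ (j : Fin b) → sumFin (λ k → a k * χ (N (rows k) j)) mod p ≡ 0) →
    ∀ k → a k mod p ≡ 0

IsRankOver : (p : ℕ) → ∀ {m b} → (Fin m → Fin b → Bool) → ℕ → Set
IsRankOver p {m} N r =
  (Σ (Fin r → Fin m) λ rows → RowsIndependent p N rows) ×
  (∀ (rows : Fin (suc r) → Fin m) → ¬ RowsIndependent p N rows)

-- The residual design of D1 (incidence N1, v1 points, v1 blocks) w.r.t.
-- block B is isomorphic to D (incidence N): a bijection σ from points of D onto
-- the points of D1 outside B and a bijection τ from blocks of D onto the blocks
-- of D1 other than B, preserving incidence.
ResidualIso : ∀ {v b v1} → (Fin v → Fin b → Bool) → (Fin v1 → Fin v1 → Bool) → Fin v1 → Set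
ResidualIso {v} {b} {v1} N N1 B =
  Σ (Fin v → Fin v1) λ σ → Σ (Fin b → Fin v1) λ τ →
    Injective _≡_ _≡_ σ × (∀ x → N1 (σ x) B ≡ false) ×
    (∀ y → N1 y B ≡ false → ∃ λ x → σ x ≡ y) ×
    Injective _≡_ _≡_ τ × (∀ j → τ j ≢ B) ×
    (∀ j → j ≢ B → ∃ λ j' → τ j' ≡ j) ×
    (∀ x j → N x j ≡ N1 (σ x) (τ j))

LinEmbeddableResidual : (p : ℕ) → ∀ {v b v1} → (Fin v → Fin b → Bool) → (Fin v1 → Fin v1 → Bool) → Fin v1 → Set
LinEmbeddableResidual p N N1 B =
  ResidualIso N N1 B × (Σ ℕ λ r → IsRankOver p N r × IsRankOver p N1 (suc r))

-- Block B of D1 is normal (for parameters q, n): the derived design at B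
-- (points of B, blocks B ∩ B_j, j ≠ B) is q identical copies of the block set
-- of a symmetric 2-(θ q n, θ q (n-1), θ q (n-2)) design E (incidence M):
-- π is a bijection from the points of E onto B, ρ sends each block j ≠ B to a
-- block of E with the same trace on B, and each block of E is hit by exactly
-- q blocks j ≠ B.
IsNormalBlock : (q n : ℕ) → ∀ {v1} → (Fin v1 → Fin v1 → Bool) → Fin v1 → Set
IsNormalBlock q n {v1} N1 B =
  Σ (Fin (θ q n) → Fin (θ q n) → Bool) λ M →
    IsSymmetric2Design (θ q n) (θ q (n ∸ 1)) (θ q (n ∸ 2)) M ×
    Σ (Fin (θ q n) → Fin v1) λ π → Σ (Fin v1 → Fin (θ q n)) λ ρ →
      Injective _≡_ _≡_ π × (∀ x → N1 (π x) B ≡ true) ×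
      (∀ y → N1 y B ≡ true → ∃ λ x → π x ≡ y) ×
      (∀ j → j ≢ B → ∀ x → N1 (π x) j ≡ M x (ρ j)) ×
      (∀ e → count (λ j → not (j ≡ᶠ B) ∧ (ρ j ≡ᶠ e)) ≡ q)

-- w is a codeword of the GF(p)-code spanned by the rows of N
-- (entries of w are the residues in {0,…,p-1})
InCode : (p : ℕ) → ∀ {v b} → (Fin v → Fin b → Bool) → (Fin b → ℕ) → Set
InCode p {v} N w = ∃ λ (a : Fin v → ℕ) → ∀ j → w j ≡ sumFin (λ x → a x * χ (N x j)) mod p

weight : ∀ {b} → (Fin b → ℕ) → ℕ
weight w = count (λ j → not (w j ≡ᵇ 0))

SupportUnionOfClasses : ∀ {b m} → (Fin b → Fin m) → (Fin b → ℕ) → Set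
SupportUnionOfClasses c w = ∀ j j' → c j ≡ c j' → w j ≡ 0 → w j' ≡ 0

-- Let u ≠ w be points of the normal block B and c ∈ GF(p)ˣ.  The word c·(row u − row w) of the incidence
-- matrix of D1, read on the blocks other than B, lies in the code of D: as rank D1 = rank D + 1, the rows
-- u and w depend on the rows of D lifted to D1, and column B forces them to enter with opposite
-- coefficients.  It has weight |u △ w| = 2(θ(n) − θ(n−1)) = 2q^(n−1) by the symmetric design equations.
-- Parallel blocks of D extend to blocks of D1 that are disjoint off B and meet in L points, so they have
-- the same trace on B and the word is constant on parallel classes.  Finally, in a symmetric design with
-- q ≥ 3 the symmetric difference of two rows determines the pair, so the (p − 1)·C(θ(n), 2) choices of
-- c and of a pair of the θ(n) points of B give distinct words.

module Submission where

open import Defs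
open import Data.Bool using (Bool; true; false; _∧_; not; _xor_)
open import Data.Bool.Properties using (∧-zeroʳ; ∧-identityʳ; ∧-idem; ∧-assoc; ∧-comm; xor-comm; ⇔→≡)
open import Data.Empty using (⊥-elim)
open import Data.Fin using (Fin; zero; suc; toℕ; fromℕ<; splitAt; join; cast; finToFun; funToFin; quotient; remainder; combine)
import Data.Fin.Properties as Fin
open import Data.Nat using (ℕ; zero; suc; _+_; _*_; _∸_; _^_; _≤_; _<_; z≤n; s≤s; _%_; _/_; _≡ᵇ_; NonZero; >-nonZero; >-nonZero⁻¹)
open import Data.Nat.Combinatorics using (_C_; nC1≡n; nCk+nC[k+1]≡[n+1]C[k+1])
open import Data.Nat.Divisibility using (∣⇒≤)
open import Data.Nat.DivMod using (m*n/n≡m; %-distribˡ-+; %-distribˡ-*; n%n≡0; m%n%n≡m%n; m<n⇒m%n≡m; m%n<n)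
open import Data.Nat.GCD using (module GCD; module Bézout)
open import Data.Nat.Primality using (Prime; prime⇒irreducible; prime⇒nonZero)
open import Data.Nat.Properties
open import Data.Nat.Tactic.RingSolver using (solve-∀)
open import Data.Product using (Σ; ∃; _×_; _,_; proj₁; proj₂)
open import Data.Sum using (_⊎_; inj₁; inj₂; reduce)
open import Function.Bundles using (mk⇔)
open import Function.Definitions using (Injective)
open import Relation.Binary using (IsEquivalence; Setoid)
open import Relation.Binary.PropositionalEquality
open import Relation.Nullary using (¬_; Dec; yes; no; ¬?; _×-dec_)
open import Relation.Nullary.Decidable using (map′)
open import Algebra.Properties.Semiring.Sum +-*-semiring using (sum; ∑-distrib-+; ∑-comm; *-distribˡ-sum)

-- Finite sums and counts

true≢false : true ≢ false
true≢false ()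

∧-not-true : ∀ {a b} → (a ∧ not b) ≡ true → a ≡ true × b ≡ false
∧-not-true {true} {false} _ = refl , refl

≡ᶠ-refl : ∀ {n} (i : Fin n) → (i ≡ᶠ i) ≡ true
≡ᶠ-refl zero    = refl
≡ᶠ-refl (suc i) = ≡ᶠ-refl i

≡ᶠ⇒≡ : ∀ {n} {i j : Fin n} → (i ≡ᶠ j) ≡ true → i ≡ j
≡ᶠ⇒≡ {i = zero}  {zero}  _ = refl
≡ᶠ⇒≡ {i = suc i} {suc j} e = cong suc (≡ᶠ⇒≡ e)

≢⇒≡ᶠ-false : ∀ {n} {i j : Fin n} → i ≢ j → (i ≡ᶠ j) ≡ false
≢⇒≡ᶠ-false {i = i} {j} i≢j with i ≡ᶠ j in eq
... | true  = ⊥-elim (i≢j (≡ᶠ⇒≡ eq))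
... | false = refl

≡ᶠ-false⇒≢ : ∀ {n} {i j : Fin n} → (i ≡ᶠ j) ≡ false → i ≢ j
≡ᶠ-false⇒≢ {i = i} e refl = true≢false (trans (sym (≡ᶠ-refl i)) e)

χ-∧ : ∀ a b → χ (a ∧ b) ≡ χ a * χ b
χ-∧ true  b = sym (+-identityʳ (χ b))
χ-∧ false b = refl

sumFin-cong : ∀ {n} {f g : Fin n → ℕ} → (∀ i → f i ≡ g i) → sumFin f ≡ sumFin g
sumFin-cong {zero}  e = refl
sumFin-cong {suc n} e = cong₂ _+_ (e zero) (sumFin-cong (λ i → e (suc i)))

sumFin≡sum : ∀ {n} (f : Fin n → ℕ) → sumFin f ≡ sum f
sumFin≡sum {zero}  f = refl
sumFin≡sum {suc n} f = cong (f zero +_) (sumFin≡sum (λ i → f (suc i)))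

sumFin-+ : ∀ {n} (f g : Fin n → ℕ) → sumFin (λ i → f i + g i) ≡ sumFin f + sumFin g
sumFin-+ f g = begin
  sumFin (λ i → f i + g i) ≡⟨ sumFin≡sum (λ i → f i + g i) ⟩
  sum (λ i → f i + g i)    ≡⟨ ∑-distrib-+ f g ⟩
  sum f + sum g            ≡⟨ cong₂ _+_ (sumFin≡sum f) (sumFin≡sum g) ⟨
  sumFin f + sumFin g      ∎
  where open ≡-Reasoning

sumFin-*ˡ : ∀ {n} c (f : Fin n → ℕ) → sumFin (λ i → c * f i) ≡ c * sumFin f
sumFin-*ˡ c f = begin
  sumFin (λ i → c * f i) ≡⟨ sumFin≡sum (λ i → c * f i) ⟩
  sum (λ i → c * f i)    ≡⟨ *-distribˡ-sum c f ⟨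
  c * sum f              ≡⟨ cong (c *_) (sumFin≡sum f) ⟨
  c * sumFin f           ∎
  where open ≡-Reasoning

sumFin-*ʳ : ∀ {n} (f : Fin n → ℕ) c → sumFin (λ i → f i * c) ≡ sumFin f * c
sumFin-*ʳ f c = trans (sumFin-cong (λ i → *-comm (f i) c)) (trans (sumFin-*ˡ c f) (*-comm c (sumFin f)))

sumFin-swap : ∀ {m n} (h : Fin m → Fin n → ℕ) →
  sumFin (λ i → sumFin (h i)) ≡ sumFin (λ j → sumFin (λ i → h i j))
sumFin-swap h = begin
  sumFin (λ i → sumFin (h i))              ≡⟨ sumFin-cong (λ i → sumFin≡sum (h i)) ⟩
  sumFin (λ i → sum (h i))                 ≡⟨ sumFin≡sum (λ i → sum (h i)) ⟩
  sum (λ i → sum (h i))                    ≡⟨ ∑-comm h ⟩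
  sum (λ j → sum (λ i → h i j))            ≡⟨ sumFin≡sum (λ j → sum (λ i → h i j)) ⟨
  sumFin (λ j → sum (λ i → h i j))         ≡⟨ sumFin-cong (λ j → sumFin≡sum (λ i → h i j)) ⟨
  sumFin (λ j → sumFin (λ i → h i j))      ∎
  where open ≡-Reasoning

sumFin-const : ∀ {n} c → sumFin {n} (λ _ → c) ≡ n * c
sumFin-const {zero}  c = refl
sumFin-const {suc n} c = cong (c +_) (sumFin-const {n} c)

sumFin-zero : ∀ {n} → sumFin {n} (λ _ → 0) ≡ 0
sumFin-zero {n} = trans (sumFin-const {n} 0) (*-zeroʳ n)

sumFin-indicator : ∀ {n} (i₀ : Fin n) (h : Fin n → ℕ) → sumFin (λ i → χ (i ≡ᶠ i₀) * h i) ≡ h i₀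
sumFin-indicator {suc n} zero     h = trans (cong₂ _+_ (+-identityʳ (h zero)) (sumFin-zero {n})) (+-identityʳ (h zero))
sumFin-indicator {suc n} (suc i₀) h = sumFin-indicator i₀ (λ i → h (suc i))

sumFin-except : ∀ {n} → Fin n → (Fin n → ℕ) → ℕ
sumFin-except i₀ h = sumFin (λ i → χ (not (i ≡ᶠ i₀)) * h i)

sumFin-remove : ∀ {n} (i₀ : Fin n) (h : Fin n → ℕ) → sumFin h ≡ h i₀ + sumFin-except i₀ h
sumFin-remove i₀ h = begin
  sumFin h                                          ≡⟨ sumFin-cong (λ i → split (i ≡ᶠ i₀) (h i)) ⟩
  sumFin (λ i → χ (i ≡ᶠ i₀) * h i + χ (not (i ≡ᶠ i₀)) * h i)
                                                    ≡⟨ sumFin-+ (λ i → χ (i ≡ᶠ i₀) * h i) (λ i → χ (not (i ≡ᶠ i₀)) * h i) ⟩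
  sumFin (λ i → χ (i ≡ᶠ i₀) * h i) + sumFin-except i₀ h
                                                    ≡⟨ cong₂ _+_ (sumFin-indicator i₀ h) refl ⟩
  h i₀ + sumFin-except i₀ h                         ∎
  where
  open ≡-Reasoning
  split : ∀ b x → x ≡ χ b * x + χ (not b) * x
  split true  x = sym (trans (+-identityʳ _) (+-identityʳ x))
  split false x = sym (+-identityʳ x)

except-weight : ∀ {n} {i₀ i : Fin n} → i ≢ i₀ → ∀ x → χ (not (i ≡ᶠ i₀)) * x ≡ x
except-weight i≢i₀ x rewrite ≢⇒≡ᶠ-false i≢i₀ = +-identityʳ x

sumFin-except-cong : ∀ {n} (i₀ : Fin n) {f g : Fin n → ℕ} → (∀ i → i ≢ i₀ → f i ≡ g i) →
  sumFin-except i₀ f ≡ sumFin-except i₀ g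
sumFin-except-cong i₀ {f} {g} e = sumFin-cong pointwise
  where
  pointwise : ∀ i → χ (not (i ≡ᶠ i₀)) * f i ≡ χ (not (i ≡ᶠ i₀)) * g i
  pointwise i with i Fin.≟ i₀
  ... | yes refl rewrite ≡ᶠ-refl i₀ = refl
  ... | no  i≢i₀ = trans (except-weight i≢i₀ (f i)) (trans (e i i≢i₀) (sym (except-weight i≢i₀ (g i))))

sumFin-mono-≤ : ∀ {n} {f g : Fin n → ℕ} → (∀ i → f i ≤ g i) → sumFin f ≤ sumFin g
sumFin-mono-≤ {zero}  le = z≤n
sumFin-mono-≤ {suc n} le = +-mono-≤ (le zero) (sumFin-mono-≤ (λ i → le (suc i)))

sumFin-≤-≡⇒≡ : ∀ {n} {f g : Fin n → ℕ} → (∀ i → f i ≤ g i) → sumFin f ≡ sumFin g → ∀ i → f i ≡ g i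
sumFin-≤-≡⇒≡ {suc n} {f} {g} le e = λ where
    zero    → head≡
    (suc i) → sumFin-≤-≡⇒≡ (λ i → le (suc i)) (+-cancelˡ-≡ (f zero) _ _ (trans e (cong₂ _+_ (sym head≡) refl))) i
  where
  head≡ : f zero ≡ g zero
  head≡ = ≤-antisym (le zero)
    (+-cancelʳ-≤ _ _ _ (≤-trans (+-monoʳ-≤ (g zero) (sumFin-mono-≤ (λ i → le (suc i)))) (≤-reflexive (sym e))))

count-cong : ∀ {n} {f g : Fin n → Bool} → (∀ i → f i ≡ g i) → count f ≡ count g
count-cong {zero}  e = refl
count-cong {suc n} e = cong₂ _+_ (cong χ (e zero)) (count-cong (λ i → e (suc i)))

count≡sumFin : ∀ {n} (f : Fin n → Bool) → count f ≡ sumFin (λ i → χ (f i))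
count≡sumFin {zero}  f = refl
count≡sumFin {suc n} f = cong (χ (f zero) +_) (count≡sumFin (λ i → f (suc i)))

count-false : ∀ {n} (f : Fin n → Bool) → (∀ i → f i ≡ false) → count f ≡ 0
count-false {n} f e = trans (count-cong e) (trans (count≡sumFin {n} (λ _ → false)) (sumFin-zero {n}))

count-+ : ∀ {n} (f g h : Fin n → Bool) → (∀ i → χ (f i) ≡ χ (g i) + χ (h i)) → count f ≡ count g + count h
count-+ f g h e = begin
  count f                                          ≡⟨ count≡sumFin f ⟩
  sumFin (λ i → χ (f i))                           ≡⟨ sumFin-cong e ⟩
  sumFin (λ i → χ (g i) + χ (h i))                 ≡⟨ sumFin-+ (λ i → χ (g i)) (λ i → χ (h i)) ⟩
  sumFin (λ i → χ (g i)) + sumFin (λ i → χ (h i))  ≡⟨ cong₂ _+_ (count≡sumFin g) (count≡sumFin h) ⟨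
  count g + count h                                ∎
  where open ≡-Reasoning

count-≤-+ : ∀ {n} (f g h : Fin n → Bool) → (∀ i → χ (f i) ≤ χ (g i) + χ (h i)) → count f ≤ count g + count h
count-≤-+ f g h le = begin
  count f                                          ≡⟨ count≡sumFin f ⟩
  sumFin (λ i → χ (f i))                           ≤⟨ sumFin-mono-≤ le ⟩
  sumFin (λ i → χ (g i) + χ (h i))                 ≡⟨ sumFin-+ (λ i → χ (g i)) (λ i → χ (h i)) ⟩
  sumFin (λ i → χ (g i)) + sumFin (λ i → χ (h i))  ≡⟨ cong₂ _+_ (count≡sumFin g) (count≡sumFin h) ⟨
  count g + count h                                ∎
  where open ≤-Reasoning

count-split : ∀ {n} (f g : Fin n → Bool) → count f ≡ count (λ i → f i ∧ g i) + count (λ i → f i ∧ not (g i))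
count-split f g = count-+ f (λ i → f i ∧ g i) (λ i → f i ∧ not (g i)) (λ i → split (f i) (g i))
  where
  split : ∀ a b → χ a ≡ χ (a ∧ b) + χ (a ∧ not b)
  split true  true  = refl
  split true  false = refl
  split false b     = refl

count-∧≡sumFin : ∀ {n} (f g : Fin n → Bool) → count (λ i → f i ∧ g i) ≡ sumFin (λ i → χ (f i) * χ (g i))
count-∧≡sumFin f g = trans (count≡sumFin (λ i → f i ∧ g i)) (sumFin-cong (λ i → χ-∧ (f i) (g i)))

double-counting : ∀ {m n} (w : Fin m → ℕ) (u : Fin n → ℕ) (R : Fin m → Fin n → Bool) →
  sumFin (λ i → w i * sumFin (λ j → u j * χ (R i j))) ≡ sumFin (λ j → u j * sumFin (λ i → w i * χ (R i j)))
double-counting w u R = begin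
  sumFin (λ i → w i * sumFin (λ j → u j * χ (R i j)))   ≡⟨ sumFin-cong (λ i → sumFin-*ˡ (w i) (λ j → u j * χ (R i j))) ⟨
  sumFin (λ i → sumFin (λ j → w i * (u j * χ (R i j)))) ≡⟨ sumFin-swap (λ i j → w i * (u j * χ (R i j))) ⟩
  sumFin (λ j → sumFin (λ i → w i * (u j * χ (R i j)))) ≡⟨ sumFin-cong (λ j → sumFin-cong (λ i → exchange (w i) (u j) _)) ⟩
  sumFin (λ j → sumFin (λ i → u j * (w i * χ (R i j)))) ≡⟨ sumFin-cong (λ j → sumFin-*ˡ (u j) (λ i → w i * χ (R i j))) ⟩
  sumFin (λ j → u j * sumFin (λ i → w i * χ (R i j)))   ∎
  where
  open ≡-Reasoning
  exchange : ∀ a b c → a * (b * c) ≡ b * (a * c)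
  exchange = solve-∀

count-∧-≡ᶠ : ∀ {n} (i₀ : Fin n) (f : Fin n → Bool) → count (λ i → f i ∧ (i ≡ᶠ i₀)) ≡ χ (f i₀)
count-∧-≡ᶠ i₀ f = begin
  count (λ i → f i ∧ (i ≡ᶠ i₀))           ≡⟨ count≡sumFin (λ i → f i ∧ (i ≡ᶠ i₀)) ⟩
  sumFin (λ i → χ (f i ∧ (i ≡ᶠ i₀)))      ≡⟨ sumFin-cong (λ i → trans (χ-∧ (f i) _) (*-comm (χ (f i)) _)) ⟩
  sumFin (λ i → χ (i ≡ᶠ i₀) * χ (f i))    ≡⟨ sumFin-indicator i₀ (λ i → χ (f i)) ⟩
  χ (f i₀)                                ∎
  where open ≡-Reasoning

count-remove : ∀ {n} (i₀ : Fin n) (f : Fin n → Bool) → count f ≡ χ (f i₀) + count (λ i → f i ∧ not (i ≡ᶠ i₀))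
count-remove i₀ f = trans (count-split f (_≡ᶠ i₀)) (cong₂ _+_ (count-∧-≡ᶠ i₀ f) refl)

true⇒count≥1 : ∀ {n} (f : Fin n → Bool) {i} → f i ≡ true → 1 ≤ count f
true⇒count≥1 f {zero}  e rewrite e = s≤s z≤n
true⇒count≥1 f {suc i} e = ≤-trans (true⇒count≥1 (λ i → f (suc i)) e) (m≤n+m _ (χ (f zero)))

count≥1⇒∃ : ∀ {n} (f : Fin n → Bool) → 1 ≤ count f → ∃ λ i → f i ≡ true
count≥1⇒∃ {suc n} f le with f zero in f0
... | true  = zero , f0
... | false with count≥1⇒∃ (λ i → f (suc i)) le
...   | i , e = suc i , e

count≡1⇒unique : ∀ {n} (f : Fin n → Bool) → count f ≡ 1 → ∀ {i j} → f i ≡ true → f j ≡ true → i ≡ j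
count≡1⇒unique f c1 {i} {j} fi fj with j Fin.≟ i
... | yes j≡i = sym j≡i
... | no  j≢i = ⊥-elim (<-irrefl refl (begin-strict
    1                                              ≡⟨ cong χ fi ⟨
    χ (f i)                                        <⟨ m<m+n (χ (f i)) (true⇒count≥1 (λ k → f k ∧ not (k ≡ᶠ i)) fj') ⟩
    χ (f i) + count (λ k → f k ∧ not (k ≡ᶠ i))     ≡⟨ count-remove i f ⟨
    count f                                        ≡⟨ c1 ⟩
    1                                              ∎))
  where
  open ≤-Reasoning
  fj' : (f j ∧ not (j ≡ᶠ i)) ≡ true
  fj' = cong₂ (λ a b → a ∧ not b) fj (≢⇒≡ᶠ-false j≢i)

count-∧≡count⇒⊆ : ∀ {n} (f g : Fin n → Bool) → count (λ i → f i ∧ g i) ≡ count f →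
  ∀ {i} → f i ≡ true → g i ≡ true
count-∧≡count⇒⊆ f g e {i} fi with g i in gi
... | true  = refl
... | false = ⊥-elim (<-irrefl refl (begin-strict
    count (λ k → f k ∧ g k) + 0                          <⟨ +-monoʳ-< _ (true⇒count≥1 (λ k → f k ∧ not (g k)) fgi) ⟩
    count (λ k → f k ∧ g k) + count (λ k → f k ∧ not (g k)) ≡⟨ count-split f g ⟨
    count f                                              ≡⟨ e ⟨
    count (λ k → f k ∧ g k)                              ≡⟨ +-identityʳ _ ⟨
    count (λ k → f k ∧ g k) + 0                          ∎))
  where
  open ≤-Reasoning
  fgi : (f i ∧ not (g i)) ≡ true
  fgi = cong₂ (λ a b → a ∧ not b) fi gi

count-∘-injective : ∀ {b v} (τ : Fin b → Fin v) → Injective _≡_ _≡_ τ → (g : Fin v → Bool) →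
  (∀ {J} → g J ≡ true → ∃ λ j → τ j ≡ J) → count (λ j → g (τ j)) ≡ count g
count-∘-injective {zero} τ _ g onto = sym (count-false g absent)
  where
  absent : ∀ J → g J ≡ false
  absent J with g J in gJ
  ... | false = refl
  ... | true  with onto gJ
  ...   | () , _
count-∘-injective {suc b} τ τ-inj g onto = begin
  χ (g (τ zero)) + count (λ j → g (τ (suc j)))  ≡⟨ cong₂ _+_ refl (count-cong (λ j → sym (g′∘τ-suc j))) ⟩
  χ (g (τ zero)) + count (λ j → g′ (τ (suc j)))
    ≡⟨ cong₂ _+_ refl (count-∘-injective (λ j → τ (suc j)) (λ e → Fin.suc-injective (τ-inj e)) g′ onto′) ⟩
  χ (g (τ zero)) + count g′                     ≡⟨ count-remove (τ zero) g ⟨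
  count g                                       ∎
  where
  open ≡-Reasoning
  g′ : _ → Bool
  g′ J = g J ∧ not (J ≡ᶠ τ zero)
  g′∘τ-suc : ∀ j → g′ (τ (suc j)) ≡ g (τ (suc j))
  g′∘τ-suc j rewrite ≢⇒≡ᶠ-false {i = τ (suc j)} {τ zero} (λ e → Fin.0≢1+n (sym (τ-inj e))) = ∧-identityʳ _
  onto′ : ∀ {J} → g′ J ≡ true → ∃ λ j → τ (suc j) ≡ J
  onto′ e with onto (proj₁ (∧-not-true e))
  ... | zero  , τ0≡J = ⊥-elim (≡ᶠ-false⇒≢ (proj₂ (∧-not-true e)) (sym τ0≡J))
  ... | suc j , τj≡J = j , τj≡J

-- Arithmetic

geomSum : ℕ → ℕ → ℕ
geomSum q zero    = 0
geomSum q (suc m) = q * geomSum q m + 1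

geomSum-closed : ∀ d m → d * geomSum (suc d) m + 1 ≡ suc d ^ m
geomSum-closed d zero    = cong (_+ 1) (*-zeroʳ d)
geomSum-closed d (suc m) = trans (step d (geomSum (suc d) m)) (cong (suc d *_) (geomSum-closed d m))
  where
  step : ∀ d g → d * (suc d * g + 1) + 1 ≡ suc d * (d * g + 1)
  step = solve-∀

θ≡geomSum : ∀ {q} m → 2 ≤ q → θ q m ≡ geomSum q m
θ≡geomSum {suc (suc d)} m _ = begin
  (suc (suc d) ^ m ∸ 1) / suc d                  ≡⟨ cong (λ x → (x ∸ 1) / suc d) (geomSum-closed (suc d) m) ⟨
  (suc d * geomSum (suc (suc d)) m + 1 ∸ 1) / suc d ≡⟨ cong (_/ suc d) (m+n∸n≡m (suc d * geomSum (suc (suc d)) m) 1) ⟩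
  (suc d * geomSum (suc (suc d)) m) / suc d      ≡⟨ cong (_/ suc d) (*-comm (suc d) (geomSum (suc (suc d)) m)) ⟩
  (geomSum (suc (suc d)) m * suc d) / suc d      ≡⟨ m*n/n≡m (geomSum (suc (suc d)) m) (suc d) ⟩
  geomSum (suc (suc d)) m                        ∎
  where open ≡-Reasoning
θ≡geomSum {suc zero} m (s≤s ())

θ-suc : ∀ {q} m → 2 ≤ q → θ q (suc m) ≡ q * θ q m + 1
θ-suc {q} m q≥2 = trans (θ≡geomSum (suc m) q≥2) (cong (λ x → q * x + 1) (sym (θ≡geomSum m q≥2)))

θ-suc-^ : ∀ {q} m → 2 ≤ q → θ q (suc m) ≡ q ^ m + θ q m
θ-suc-^ {suc (suc d)} m q≥2 = begin
  θ q (suc m)                      ≡⟨ θ≡geomSum (suc m) q≥2 ⟩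
  q * g + 1                        ≡⟨ split (suc d) g ⟩
  (suc d * g + 1) + g              ≡⟨ cong₂ _+_ (geomSum-closed (suc d) m) (sym (θ≡geomSum m q≥2)) ⟩
  q ^ m + θ q m                    ∎
  where
  open ≡-Reasoning
  q g : ℕ
  q = suc (suc d)
  g = geomSum q m
  split : ∀ d g → suc d * g + 1 ≡ (d * g + 1) + g
  split = solve-∀
θ-suc-^ {suc zero} m (s≤s ())

positive⇒nonzero : ∀ {x} → 1 ≤ x → not (x ≡ᵇ 0) ≡ true
positive⇒nonzero {suc x} _ = refl

mod≡% : ∀ a P .{{_ : NonZero P}} → a mod P ≡ a % P
mod≡% a (suc d) = refl

module Modulo (P : ℕ) .{{_ : NonZero P}} where

  infix 4 _≈_
  record _≈_ (a b : ℕ) : Set where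
    constructor mk≈
    field ≈⇒%≡ : a % P ≡ b % P
  open _≈_ public

  ≈-isEquivalence : IsEquivalence _≈_
  ≈-isEquivalence = record
    { refl  = mk≈ refl
    ; sym   = λ (mk≈ e) → mk≈ (sym e)
    ; trans = λ (mk≈ e) (mk≈ e′) → mk≈ (trans e e′)
    }

  ≈-setoid : Setoid _ _
  ≈-setoid = record { isEquivalence = ≈-isEquivalence }

  open IsEquivalence ≈-isEquivalence public using () renaming (refl to ≈-refl; sym to ≈-sym; trans to ≈-trans)

  ≡⇒≈ : ∀ {a b} → a ≡ b → a ≈ b
  ≡⇒≈ e = mk≈ (cong (_% P) e)

  _≈?_ : ∀ a b → Dec (a ≈ b)
  a ≈? b = map′ mk≈ ≈⇒%≡ (a % P ≟ b % P)

  +-cong-≈ : ∀ {a a′ b b′} → a ≈ a′ → b ≈ b′ → a + b ≈ a′ + b′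
  +-cong-≈ {a} {a′} {b} {b′} (mk≈ e) (mk≈ e′) = mk≈ (begin
    (a + b) % P               ≡⟨ %-distribˡ-+ a b P ⟩
    (a % P + b % P) % P       ≡⟨ cong₂ (λ x y → (x + y) % P) e e′ ⟩
    (a′ % P + b′ % P) % P     ≡⟨ %-distribˡ-+ a′ b′ P ⟨
    (a′ + b′) % P             ∎)
    where open ≡-Reasoning

  *-cong-≈ : ∀ {a a′ b b′} → a ≈ a′ → b ≈ b′ → a * b ≈ a′ * b′
  *-cong-≈ {a} {a′} {b} {b′} (mk≈ e) (mk≈ e′) = mk≈ (begin
    (a * b) % P               ≡⟨ %-distribˡ-* a b P ⟩
    (a % P * (b % P)) % P     ≡⟨ cong₂ (λ x y → (x * y) % P) e e′ ⟩
    (a′ % P * (b′ % P)) % P   ≡⟨ %-distribˡ-* a′ b′ P ⟨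
    (a′ * b′) % P             ∎)
    where open ≡-Reasoning

  sumFin-cong-≈ : ∀ {n} {f g : Fin n → ℕ} → (∀ i → f i ≈ g i) → sumFin f ≈ sumFin g
  sumFin-cong-≈ {zero}  e = ≈-refl
  sumFin-cong-≈ {suc n} e = +-cong-≈ (e zero) (sumFin-cong-≈ (λ i → e (suc i)))

  0%P≡0 : 0 % P ≡ 0
  0%P≡0 = m<n⇒m%n≡m (>-nonZero⁻¹ P)

  mod≡0⇒≈0 : ∀ {a} → a mod P ≡ 0 → a ≈ 0
  mod≡0⇒≈0 {a} e = mk≈ (trans (sym (mod≡% a P)) (trans e (sym 0%P≡0)))

  ≈0⇒mod≡0 : ∀ {a} → a ≈ 0 → a mod P ≡ 0
  ≈0⇒mod≡0 {a} (mk≈ e) = trans (mod≡% a P) (trans e 0%P≡0)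

  P≈0 : P ≈ 0
  P≈0 = mk≈ (trans (n%n≡0 P) (sym 0%P≡0))

  %-≈ : ∀ a → a % P ≈ a
  %-≈ a = mk≈ (m%n%n≡m%n a P)

  ≈⇒≡ : ∀ {a b} → a < P → b < P → a ≈ b → a ≡ b
  ≈⇒≡ a<P b<P (mk≈ e) = trans (sym (m<n⇒m%n≡m a<P)) (trans e (m<n⇒m%n≡m b<P))

  ≈0⇒≡0 : ∀ {a} → a < P → a ≈ 0 → a ≡ 0
  ≈0⇒≡0 a<P = ≈⇒≡ a<P (>-nonZero⁻¹ P)

  P∸1+1 : P ∸ 1 + 1 ≡ P
  P∸1+1 = m∸n+n≡m (>-nonZero⁻¹ P)

  -- P ∸ 1 plays the role of -1.
  ≈-negate : ∀ {x y} → x + y ≈ 0 → x ≈ (P ∸ 1) * y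
  ≈-negate {x} {y} x+y≈0 = begin
    x                         ≡⟨ +-identityʳ x ⟨
    x + 0                     ≈⟨ +-cong-≈ (≈-refl {x}) (≈-sym (*-cong-≈ P≈0 (≈-refl {y}))) ⟩
    x + P * y                 ≡⟨ cong (λ p → x + p * y) (sym P∸1+1) ⟩
    x + (P ∸ 1 + 1) * y       ≡⟨ shuffle x y (P ∸ 1) ⟩
    (x + y) + (P ∸ 1) * y     ≈⟨ +-cong-≈ x+y≈0 (≈-refl {(P ∸ 1) * y}) ⟩
    (P ∸ 1) * y               ∎
    where
    open import Relation.Binary.Reasoning.Setoid ≈-setoid
    shuffle : ∀ x y m → x + (m + 1) * y ≡ (x + y) + m * y
    shuffle = solve-∀

  P∸c≈-c : ∀ {c} → c ≤ P → P ∸ c ≈ (P ∸ 1) * c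
  P∸c≈-c c≤P = ≈-negate (≈-trans (≡⇒≈ (m∸n+n≡m c≤P)) P≈0)

  residue-support : ∀ {c} → 1 ≤ c → c < P → ∀ a a′ → not ((c * χ a + (P ∸ c) * χ a′) % P ≡ᵇ 0) ≡ (a xor a′)
  residue-support {c} c≥1 c<P true true = cong (λ x → not (x ≡ᵇ 0)) (begin
    (c * 1 + (P ∸ c) * 1) % P  ≡⟨ cong (_% P) (cong₂ _+_ (*-identityʳ c) (*-identityʳ (P ∸ c))) ⟩
    (c + (P ∸ c)) % P          ≡⟨ cong (_% P) (m+[n∸m]≡n (<⇒≤ c<P)) ⟩
    P % P                      ≡⟨ ≈⇒%≡ P≈0 ⟩
    0 % P                      ≡⟨ 0%P≡0 ⟩
    0                          ∎)
    where open ≡-Reasoning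
  residue-support {c} c≥1 c<P true false =
    trans (cong (λ x → not (x % P ≡ᵇ 0)) (trans (cong₂ _+_ (*-identityʳ c) (*-zeroʳ (P ∸ c))) (+-identityʳ c)))
          (trans (cong (λ x → not (x ≡ᵇ 0)) (m<n⇒m%n≡m c<P)) (positive⇒nonzero c≥1))
  residue-support {c} c≥1 c<P false true =
    trans (cong (λ x → not (x % P ≡ᵇ 0)) (cong₂ _+_ (*-zeroʳ c) (*-identityʳ (P ∸ c))))
          (trans (cong (λ x → not (x ≡ᵇ 0)) (m<n⇒m%n≡m (∸-monoʳ-< {P} {c} {0} c≥1 (<⇒≤ c<P))))
                 (positive⇒nonzero (m<n⇒0<n∸m c<P)))
  residue-support {c} c≥1 c<P false false =
    trans (cong (λ x → not (x % P ≡ᵇ 0)) (cong₂ _+_ (*-zeroʳ c) (*-zeroʳ (P ∸ c)))) (cong (λ x → not (x ≡ᵇ 0)) 0%P≡0)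

  ≈-inverse : Prime P → ∀ {a} → 0 < a → a < P → ∃ λ e → e * a ≈ 1
  ≈-inverse pr {a} a>0 a<P with Bézout.lemma a P
  ... | Bézout.result d g b with prime⇒irreducible pr (GCD.gcd∣n g)
  ... | inj₂ refl = ⊥-elim (<⇒≱ a<P (∣⇒≤ {{>-nonZero a>0}} (GCD.gcd∣m g)))
  ... | inj₁ refl with b
  ... | Bézout.+- x y 1+yP≡xa = x , (begin
    x * a      ≡⟨ 1+yP≡xa ⟨
    1 + y * P  ≈⟨ +-cong-≈ (≈-refl {1}) (*-cong-≈ (≈-refl {y}) P≈0) ⟩
    1 + y * 0  ≡⟨ cong (1 +_) (*-zeroʳ y) ⟩
    1          ∎)
    where open import Relation.Binary.Reasoning.Setoid ≈-setoid
  ... | Bézout.-+ x y 1+xa≡yP = (P ∸ 1) * x , (begin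
    (P ∸ 1) * x * a    ≡⟨ *-assoc (P ∸ 1) x a ⟩
    (P ∸ 1) * (x * a)  ≈⟨ ≈-sym (≈-negate 1+xa≈0) ⟩
    1                  ∎)
    where
    open import Relation.Binary.Reasoning.Setoid ≈-setoid
    1+xa≈0 : 1 + x * a ≈ 0
    1+xa≈0 = ≈-trans (≡⇒≈ 1+xa≡yP) (≈-trans (*-cong-≈ (≈-refl {y}) P≈0) (≡⇒≈ (*-zeroʳ y)))

  KillsColumns : ∀ {m b r} → (Fin m → Fin b → Bool) → (Fin r → Fin m) → (Fin r → ℕ) → Set
  KillsColumns N rows a = ∀ j → sumFin (λ k → a k * χ (N (rows k) j)) ≈ 0

∃-fun? : ∀ {r m} {Q : (Fin r → Fin m) → Set} → (∀ {a a′} → (∀ k → a k ≡ a′ k) → Q a → Q a′) →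
  (∀ a → Dec (Q a)) → Dec (∃ Q)
∃-fun? resp Q? = map′ (λ (i , q) → finToFun i , q)
  (λ (a , q) → funToFin a , resp (λ k → sym (Fin.finToFun-funToFin a k)) q)
  (Fin.any? (λ i → Q? (finToFun i)))

module _ (P : ℕ) .{{_ : NonZero P}} {m b r} (N : Fin m → Fin b → Bool) (rows : Fin r → Fin m) where
  open Modulo P

  Dependence : (Fin r → Fin P) → Set
  Dependence a = KillsColumns N rows (λ k → toℕ (a k)) × ∃ λ k → toℕ (a k) ≢ 0

  dependence-resp : ∀ {a a′} → (∀ k → a k ≡ a′ k) → Dependence a → Dependence a′
  dependence-resp a≗a′ (kills , k , ak≢0) =
    (λ j → ≈-trans (≡⇒≈ (sumFin-cong (λ k → cong (λ x → toℕ x * χ (N (rows k) j)) (sym (a≗a′ k))))) (kills j)) ,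
    k , λ e → ak≢0 (trans (cong toℕ (a≗a′ k)) e)

  dependence? : ∀ a → Dec (Dependence a)
  dependence? a = Fin.all? (λ j → sumFin (λ k → toℕ (a k) * χ (N (rows k) j)) ≈? 0)
    ×-dec Fin.any? (λ k → ¬? (toℕ (a k) ≟ 0))

  -- A dependence may be taken with coefficients in {0, …, P-1}, and those are finitely many.
  ¬independent⇒dependence : ¬ RowsIndependent P N rows → ∃ Dependence
  ¬independent⇒dependence ¬indep with ∃-fun? dependence-resp dependence?
  ... | yes d  = d
  ... | no  ¬d = ⊥-elim (¬indep independent)
    where
    independent : RowsIndependent P N rows
    independent a kills k with a k % P ≟ 0
    ... | yes ak≡0 = trans (mod≡% (a k) P) ak≡0
    ... | no  ak≢0 = ⊥-elim (¬d (residue , residue-kills , k , λ e → ak≢0 (trans (sym (toℕ-residue k)) e)))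
      where
      residue : Fin r → Fin P
      residue k = fromℕ< (m%n<n (a k) P)
      toℕ-residue : ∀ k → toℕ (residue k) ≡ a k % P
      toℕ-residue k = Fin.toℕ-fromℕ< (m%n<n (a k) P)
      residue-kills : KillsColumns N rows (λ k → toℕ (residue k))
      residue-kills j = ≈-trans
        (sumFin-cong-≈ (λ k → *-cong-≈ (≈-trans (≡⇒≈ (toℕ-residue k)) (%-≈ (a k))) (≈-refl {χ (N (rows k) j)})))
        (mod≡0⇒≈0 (kills j))

-- Pascal's rule: the 2-subsets of Fin (suc m) are {0, k + 1} and the shifted 2-subsets of Fin m.
choose2-step : ∀ m → suc m C 2 ≡ m + m C 2
choose2-step m = sym (trans (cong (_+ m C 2) (sym (nC1≡n m))) (nCk+nC[k+1]≡[n+1]C[k+1] m 1))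

choose2 : ∀ m → Fin (m C 2) → Fin m × Fin m
choose2-split : ∀ m → Fin m ⊎ Fin (m C 2) → Fin (suc m) × Fin (suc m)
choose2 (suc m) i = choose2-split m (splitAt m (cast (choose2-step m) i))
choose2-split m (inj₁ k) = zero , suc k
choose2-split m (inj₂ k) = suc (proj₁ (choose2 m k)) , suc (proj₂ (choose2 m k))

choose2-< : ∀ m i → toℕ (proj₁ (choose2 m i)) < toℕ (proj₂ (choose2 m i))
choose2-split-< : ∀ m s → toℕ (proj₁ (choose2-split m s)) < toℕ (proj₂ (choose2-split m s))
choose2-< (suc m) i = choose2-split-< m (splitAt m (cast (choose2-step m) i))
choose2-split-< m (inj₁ k) = s≤s z≤n
choose2-split-< m (inj₂ k) = s≤s (choose2-< m k)

choose2-injective : ∀ m {i i′} → choose2 m i ≡ choose2 m i′ → i ≡ i′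
choose2-split-injective : ∀ m {s s′} → choose2-split m s ≡ choose2-split m s′ → s ≡ s′
choose2-injective (suc m) {i} {i′} e = cast-injective (begin
  cast (choose2-step m) i                                  ≡⟨ Fin.join-splitAt m (m C 2) _ ⟨
  join m (m C 2) (splitAt m (cast (choose2-step m) i))     ≡⟨ cong (join m (m C 2)) (choose2-split-injective m e) ⟩
  join m (m C 2) (splitAt m (cast (choose2-step m) i′))    ≡⟨ Fin.join-splitAt m (m C 2) _ ⟩
  cast (choose2-step m) i′                                 ∎)
  where
  open ≡-Reasoning
  cast-injective : cast (choose2-step m) i ≡ cast (choose2-step m) i′ → i ≡ i′
  cast-injective e = trans (sym (Fin.cast-involutive _ (choose2-step m) i))
    (trans (cong (cast (sym (choose2-step m))) e) (Fin.cast-involutive _ (choose2-step m) i′))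
choose2-split-injective m {inj₁ k} {inj₁ k′} e = cong inj₁ (Fin.suc-injective (cong proj₂ e))
choose2-split-injective m {inj₂ k} {inj₂ k′} e = cong inj₂ (choose2-injective m
  (cong₂ _,_ (Fin.suc-injective (cong proj₁ e)) (Fin.suc-injective (cong proj₂ e))))
choose2-split-injective m {inj₁ k} {inj₂ k′} ()
choose2-split-injective m {inj₂ k} {inj₁ k′} ()

square-gap : ∀ x l → ∃ λ d → (x * x + l * l ≡ 2 * l * x + d * d) × (d ≡ 0 → x ≡ l)
square-gap x l with ≤-total l x
... | inj₁ l≤x with d , refl ← m≤n⇒∃[o]m+o≡n l≤x =
  d , identity l d , λ d≡0 → trans (cong (l +_) d≡0) (+-identityʳ l)
  where
  identity : ∀ l d → (l + d) * (l + d) + l * l ≡ 2 * l * (l + d) + d * d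
  identity = solve-∀
... | inj₂ x≤l with d , refl ← m≤n⇒∃[o]m+o≡n x≤l =
  d , identity x d , λ d≡0 → sym (trans (cong (x +_) d≡0) (+-identityʳ x))
  where
  identity : ∀ x d → x * x + (x + d) * (x + d) ≡ 2 * (x + d) * x + d * d
  identity = solve-∀

2lx≤x²+l² : ∀ x l → 2 * l * x ≤ x * x + l * l
2lx≤x²+l² x l with d , e , _ ← square-gap x l = ≤-trans (m≤m+n _ (d * d)) (≤-reflexive (sym e))

x²+l²≡2lx⇒x≡l : ∀ x l → x * x + l * l ≡ 2 * l * x → x ≡ l
x²+l²≡2lx⇒x≡l x l e with d , e′ , d≡0⇒x≡l ← square-gap x l =
  d≡0⇒x≡l (reduce (m*n≡0⇒m≡0∨n≡0 d (+-cancelˡ-≡ _ _ _ (trans (sym e′) (trans e (sym (+-identityʳ _)))))))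

-- Symmetric designs with the parameters of the point–hyperplane design of a projective space over GF(q)

module SymmetricDesign {V K L q : ℕ} (N1 : Fin V → Fin V → Bool) (design : IsSymmetric2Design V K L N1)
  (hK : K ≡ q * L + 1) (hV : V ≡ q * K + 1) where

  block-size : ∀ J → count (λ y → N1 y J) ≡ K
  block-size = proj₁ design

  pair-count : ∀ {y y′} → y ≢ y′ → count (λ J → N1 y J ∧ N1 y′ J) ≡ L
  pair-count = proj₂ design _ _

  -- Double counting pairs (y′, J) with y′ ≠ y and y, y′ ∈ J gives (V − 1) L = R (K − 1).
  replication : .{{_ : NonZero (q * L)}} → ∀ y → count (λ J → N1 y J) ≡ K
  replication y = *-cancelʳ-≡ R K (q * L) (trans (sym flags-by-blocks) flags-by-points)
    where
    open ≡-Reasoning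
    R : ℕ
    R = count (λ J → N1 y J)
    flags : ℕ
    flags = sumFin-except y (λ y′ → count (λ J → N1 y J ∧ N1 y′ J))

    flags-by-points : flags ≡ K * (q * L)
    flags-by-points = +-cancelˡ-≡ L _ _ (begin
      L + flags                          ≡⟨ cong (L +_) (sumFin-except-cong y (λ y′ y′≢y → pair-count (≢-sym y′≢y))) ⟩
      L + sumFin-except y (λ _ → L)      ≡⟨ sumFin-remove y (λ _ → L) ⟨
      sumFin {V} (λ _ → L)               ≡⟨ sumFin-const {V} L ⟩
      V * L                              ≡⟨ cong (_* L) hV ⟩
      (q * K + 1) * L                    ≡⟨ expand q K L ⟩
      L + K * (q * L)                    ∎)
      where
      expand : ∀ q K L → (q * K + 1) * L ≡ L + K * (q * L)
      expand = solve-∀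

    others-on-block : ∀ J → χ (N1 y J) * sumFin-except y (λ y′ → χ (N1 y′ J)) ≡ χ (N1 y J) * (q * L)
    others-on-block J with N1 y J in yJ
    ... | false = refl
    ... | true  = cong (1 *_) (+-cancelˡ-≡ 1 _ _ (begin
      1 + sumFin-except y (λ y′ → χ (N1 y′ J))          ≡⟨ cong (λ b → χ b + sumFin-except y (λ y′ → χ (N1 y′ J))) yJ ⟨
      χ (N1 y J) + sumFin-except y (λ y′ → χ (N1 y′ J)) ≡⟨ sumFin-remove y (λ y′ → χ (N1 y′ J)) ⟨
      sumFin (λ y′ → χ (N1 y′ J))                       ≡⟨ count≡sumFin (λ y′ → N1 y′ J) ⟨
      count (λ y′ → N1 y′ J)                            ≡⟨ block-size J ⟩
      K                                                 ≡⟨ trans hK (+-comm (q * L) 1) ⟩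
      1 + q * L                                         ∎))

    flags-by-blocks : flags ≡ R * (q * L)
    flags-by-blocks = begin
      flags
        ≡⟨ sumFin-cong (λ y′ → cong (χ (not (y′ ≡ᶠ y)) *_) (count-∧≡sumFin (λ J → N1 y J) (λ J → N1 y′ J))) ⟩
      sumFin (λ y′ → χ (not (y′ ≡ᶠ y)) * sumFin (λ J → χ (N1 y J) * χ (N1 y′ J)))
        ≡⟨ double-counting (λ y′ → χ (not (y′ ≡ᶠ y))) (λ J → χ (N1 y J)) N1 ⟩
      sumFin (λ J → χ (N1 y J) * sumFin-except y (λ y′ → χ (N1 y′ J)))
        ≡⟨ sumFin-cong others-on-block ⟩
      sumFin (λ J → χ (N1 y J) * (q * L))
        ≡⟨ sumFin-*ʳ (λ J → χ (N1 y J)) (q * L) ⟩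
      sumFin (λ J → χ (N1 y J)) * (q * L)
        ≡⟨ cong (_* (q * L)) (count≡sumFin (λ J → N1 y J)) ⟨
      R * (q * L) ∎

  -- With x_J = |J₀ ∩ J|, the first two moments give ∑_{J ≠ J₀} (x_J − L)² = 0.
  module BlockIntersection .{{_ : NonZero (q * L)}} (J₀ : Fin V) where
    open ≡-Reasoning

    a : Fin V → ℕ
    a y = χ (N1 y J₀)

    meet : Fin V → ℕ
    meet J = count (λ y → N1 y J₀ ∧ N1 y J)

    meet≡sumFin : ∀ J → meet J ≡ sumFin (λ y → a y * χ (N1 y J))
    meet≡sumFin J = count-∧≡sumFin (λ y → N1 y J₀) (λ y → N1 y J)

    meet-self : meet J₀ ≡ K
    meet-self = trans (count-cong (λ y → ∧-idem (N1 y J₀))) (block-size J₀)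

    sumFin-a : sumFin a ≡ K
    sumFin-a = trans (sym (count≡sumFin (λ y → N1 y J₀))) (block-size J₀)

    sumFin-meet : sumFin meet ≡ K * K
    sumFin-meet = begin
      sumFin meet                                     ≡⟨ sumFin-cong meet≡sumFin ⟩
      sumFin (λ J → sumFin (λ y → a y * χ (N1 y J)))  ≡⟨ sumFin-swap (λ J y → a y * χ (N1 y J)) ⟩
      sumFin (λ y → sumFin (λ J → a y * χ (N1 y J)))  ≡⟨ sumFin-cong (λ y → sumFin-*ˡ (a y) (λ J → χ (N1 y J))) ⟩
      sumFin (λ y → a y * sumFin (λ J → χ (N1 y J)))
        ≡⟨ sumFin-cong (λ y → cong (a y *_) (trans (sym (count≡sumFin (λ J → N1 y J))) (replication y))) ⟩
      sumFin (λ y → a y * K)                          ≡⟨ sumFin-*ʳ a K ⟩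
      sumFin a * K                                    ≡⟨ cong (_* K) sumFin-a ⟩
      K * K                                           ∎

    through-pair : ∀ y → sumFin (λ J → meet J * χ (N1 y J)) ≡ sumFin (λ y′ → a y′ * count (λ J → N1 y J ∧ N1 y′ J))
    through-pair y = begin
      sumFin (λ J → meet J * χ (N1 y J))
        ≡⟨ sumFin-cong (λ J → trans (*-comm (meet J) _) (cong (χ (N1 y J) *_) (meet≡sumFin J))) ⟩
      sumFin (λ J → χ (N1 y J) * sumFin (λ y′ → a y′ * χ (N1 y′ J)))
        ≡⟨ double-counting (λ J → χ (N1 y J)) a (λ J y′ → N1 y′ J) ⟩
      sumFin (λ y′ → a y′ * sumFin (λ J → χ (N1 y J) * χ (N1 y′ J)))
        ≡⟨ sumFin-cong (λ y′ → cong (a y′ *_) (count-∧≡sumFin (λ J → N1 y J) (λ J → N1 y′ J))) ⟨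
      sumFin (λ y′ → a y′ * count (λ J → N1 y J ∧ N1 y′ J)) ∎

    pairs-within-J₀ : ∀ y → a y * sumFin (λ y′ → a y′ * count (λ J → N1 y J ∧ N1 y′ J)) ≡ a y * (K + L * (q * L))
    pairs-within-J₀ y with N1 y J₀ in yJ₀
    ... | false = refl
    ... | true  = cong (1 *_) (begin
      sumFin (λ y′ → a y′ * count (λ J → N1 y J ∧ N1 y′ J))
        ≡⟨ sumFin-remove y (λ y′ → a y′ * count (λ J → N1 y J ∧ N1 y′ J)) ⟩
      a y * count (λ J → N1 y J ∧ N1 y J) + sumFin-except y (λ y′ → a y′ * count (λ J → N1 y J ∧ N1 y′ J))
        ≡⟨ cong₂ _+_ (cong₂ _*_ (cong χ yJ₀) (trans (count-cong (λ J → ∧-idem (N1 y J))) (replication y)))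
                     (sumFin-except-cong y (λ y′ y′≢y → cong (a y′ *_) (pair-count (≢-sym y′≢y)))) ⟩
      1 * K + sumFin-except y (λ y′ → a y′ * L)
        ≡⟨ cong₂ _+_ (*-identityˡ K) (trans (sumFin-cong (λ y′ → exchange (χ (not (y′ ≡ᶠ y))) (a y′) L))
                                            (sumFin-*ˡ L (λ y′ → χ (not (y′ ≡ᶠ y)) * a y′))) ⟩
      K + L * sumFin-except y a
        ≡⟨ cong (λ s → K + L * s) others ⟩
      K + L * (q * L) ∎)
      where
      exchange : ∀ w x l → w * (x * l) ≡ l * (w * x)
      exchange = solve-∀
      others : sumFin-except y a ≡ q * L
      others = +-cancelˡ-≡ 1 _ _ (begin
        1 + sumFin-except y a    ≡⟨ cong (λ b → χ b + sumFin-except y a) yJ₀ ⟨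
        a y + sumFin-except y a  ≡⟨ sumFin-remove y a ⟨
        sumFin a                 ≡⟨ sumFin-a ⟩
        K                        ≡⟨ trans hK (+-comm (q * L) 1) ⟩
        1 + q * L                ∎)

    sumFin-meet² : sumFin (λ J → meet J * meet J) ≡ K * (K + L * (q * L))
    sumFin-meet² = begin
      sumFin (λ J → meet J * meet J)
        ≡⟨ sumFin-cong (λ J → cong (meet J *_) (meet≡sumFin J)) ⟩
      sumFin (λ J → meet J * sumFin (λ y → a y * χ (N1 y J)))
        ≡⟨ double-counting meet a (λ J y → N1 y J) ⟩
      sumFin (λ y → a y * sumFin (λ J → meet J * χ (N1 y J)))
        ≡⟨ sumFin-cong (λ y → cong (a y *_) (through-pair y)) ⟩
      sumFin (λ y → a y * sumFin (λ y′ → a y′ * count (λ J → N1 y J ∧ N1 y′ J)))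
        ≡⟨ sumFin-cong pairs-within-J₀ ⟩
      sumFin (λ y → a y * (K + L * (q * L)))
        ≡⟨ sumFin-*ʳ a _ ⟩
      sumFin a * (K + L * (q * L))
        ≡⟨ cong (_* (K + L * (q * L))) sumFin-a ⟩
      K * (K + L * (q * L)) ∎

    except-squares : sumFin-except J₀ (λ J → meet J * meet J + L * L) ≡ 2 * q * K * L * L
    except-squares = +-cancelˡ-≡ (K * K + L * L) _ _ (begin
      (K * K + L * L) + sumFin-except J₀ (λ J → meet J * meet J + L * L)
        ≡⟨ cong (λ x → x * x + L * L + sumFin-except J₀ (λ J → meet J * meet J + L * L)) meet-self ⟨
      (meet J₀ * meet J₀ + L * L) + sumFin-except J₀ (λ J → meet J * meet J + L * L)
        ≡⟨ sumFin-remove J₀ (λ J → meet J * meet J + L * L) ⟨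
      sumFin (λ J → meet J * meet J + L * L)
        ≡⟨ sumFin-+ (λ J → meet J * meet J) (λ _ → L * L) ⟩
      sumFin (λ J → meet J * meet J) + sumFin {V} (λ _ → L * L)
        ≡⟨ cong₂ _+_ sumFin-meet² (trans (sumFin-const {V} (L * L)) (cong (_* (L * L)) hV)) ⟩
      K * (K + L * (q * L)) + (q * K + 1) * (L * L)
        ≡⟨ expand K L q ⟩
      (K * K + L * L) + 2 * q * K * L * L ∎)
      where
      expand : ∀ K L q → K * (K + L * (q * L)) + (q * K + 1) * (L * L) ≡ (K * K + L * L) + 2 * q * K * L * L
      expand = solve-∀

    except-linear : sumFin-except J₀ (λ J → 2 * L * meet J) ≡ 2 * q * K * L * L
    except-linear = +-cancelˡ-≡ (2 * L * K) _ _ (begin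
      2 * L * K + sumFin-except J₀ (λ J → 2 * L * meet J)
        ≡⟨ cong (λ x → 2 * L * x + sumFin-except J₀ (λ J → 2 * L * meet J)) meet-self ⟨
      2 * L * meet J₀ + sumFin-except J₀ (λ J → 2 * L * meet J)
        ≡⟨ sumFin-remove J₀ (λ J → 2 * L * meet J) ⟨
      sumFin (λ J → 2 * L * meet J)
        ≡⟨ sumFin-*ˡ (2 * L) meet ⟩
      2 * L * sumFin meet
        ≡⟨ cong (λ s → 2 * L * s) (trans sumFin-meet (cong (K *_) hK)) ⟩
      2 * L * (K * (q * L + 1))
        ≡⟨ expand K L q ⟩
      2 * L * K + 2 * q * K * L * L ∎)
      where
      expand : ∀ K L q → 2 * L * (K * (q * L + 1)) ≡ 2 * L * K + 2 * q * K * L * L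
      expand = solve-∀

    meet-others : ∀ J → J ≢ J₀ → meet J ≡ L
    meet-others J J≢J₀ = x²+l²≡2lx⇒x≡l (meet J) L (begin
      meet J * meet J + L * L                            ≡⟨ except-weight J≢J₀ _ ⟨
      χ (not (J ≡ᶠ J₀)) * (meet J * meet J + L * L)      ≡⟨ weighted-equal J ⟨
      χ (not (J ≡ᶠ J₀)) * (2 * L * meet J)               ≡⟨ except-weight J≢J₀ _ ⟩
      2 * L * meet J                                     ∎)
      where
      weighted-equal : ∀ J → χ (not (J ≡ᶠ J₀)) * (2 * L * meet J) ≡ χ (not (J ≡ᶠ J₀)) * (meet J * meet J + L * L)
      weighted-equal = sumFin-≤-≡⇒≡ (λ J → *-monoʳ-≤ (χ (not (J ≡ᶠ J₀))) (2lx≤x²+l² (meet J) L))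
                                     (trans except-linear (sym except-squares))

  blocks-meet : .{{_ : NonZero (q * L)}} → ∀ {J₀ J} → J ≢ J₀ → count (λ y → N1 y J₀ ∧ N1 y J) ≡ L
  blocks-meet {J₀} {J} = BlockIntersection.meet-others J₀ J

  module _ .{{_ : NonZero (q * L)}} where

    blocks-avoiding : ∀ {z y} → z ≢ y → count (λ J → N1 z J ∧ not (N1 y J)) + L ≡ K
    blocks-avoiding {z} {y} z≢y = begin
      count (λ J → N1 z J ∧ not (N1 y J)) + L                            ≡⟨ cong (_ +_) (pair-count z≢y) ⟨
      count (λ J → N1 z J ∧ not (N1 y J)) + count (λ J → N1 z J ∧ N1 y J) ≡⟨ +-comm (count (λ J → N1 z J ∧ not (N1 y J))) _ ⟩
      count (λ J → N1 z J ∧ N1 y J) + count (λ J → N1 z J ∧ not (N1 y J)) ≡⟨ count-split (N1 z) (N1 y) ⟨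
      count (λ J → N1 z J)                                               ≡⟨ replication z ⟩
      K                                                                  ∎
      where open ≡-Reasoning

    symmetric-difference : ∀ {y y′} → y ≢ y′ → count (λ J → N1 y J xor N1 y′ J) + 2 * L ≡ 2 * K
    symmetric-difference {y} {y′} y≢y′ = begin
      count (λ J → N1 y J xor N1 y′ J) + 2 * L
        ≡⟨ cong (_+ 2 * L) (count-+ _ (λ J → N1 y J ∧ not (N1 y′ J)) (λ J → N1 y′ J ∧ not (N1 y J))
                                      (λ J → split (N1 y J) (N1 y′ J))) ⟩
      (count (λ J → N1 y J ∧ not (N1 y′ J)) + count (λ J → N1 y′ J ∧ not (N1 y J))) + 2 * L
        ≡⟨ regroup (count (λ J → N1 y J ∧ not (N1 y′ J))) (count (λ J → N1 y′ J ∧ not (N1 y J))) L ⟩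
      (count (λ J → N1 y J ∧ not (N1 y′ J)) + L) + (count (λ J → N1 y′ J ∧ not (N1 y J)) + L)
        ≡⟨ cong₂ _+_ (blocks-avoiding y≢y′) (blocks-avoiding (≢-sym y≢y′)) ⟩
      K + K
        ≡⟨ cong (K +_) (+-identityʳ K) ⟨
      2 * K ∎
      where
      open ≡-Reasoning
      split : ∀ a b → χ (a xor b) ≡ χ (a ∧ not b) + χ (b ∧ not a)
      split true  true  = refl
      split true  false = refl
      split false true  = refl
      split false false = refl
      regroup : ∀ a b l → (a + b) + 2 * l ≡ (a + l) + (b + l)
      regroup = solve-∀

    symmetric-difference-size : ∀ {W} → K ≡ W + L → ∀ {y y′} → y ≢ y′ → count (λ J → N1 y J xor N1 y′ J) ≡ 2 * W
    symmetric-difference-size {W} K≡W+L y≢y′ = +-cancelʳ-≡ (2 * L) _ _ (begin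
      count (λ J → N1 _ J xor N1 _ J) + 2 * L  ≡⟨ symmetric-difference y≢y′ ⟩
      2 * K                                    ≡⟨ cong (2 *_) K≡W+L ⟩
      2 * (W + L)                              ≡⟨ *-distribˡ-+ 2 W L ⟩
      2 * W + 2 * L                            ∎)
      where open ≡-Reasoning

    separating-block : 1 ≤ q → ∀ {z y} → z ≢ y → ∃ λ J → N1 z J ≡ true × N1 y J ≡ false
    separating-block q≥1 {z} {y} z≢y with count≥1⇒∃ (λ J → N1 z J ∧ not (N1 y J)) at-least-one
      where
      at-least-one : 1 ≤ count (λ J → N1 z J ∧ not (N1 y J))
      at-least-one = +-cancelʳ-≤ L 1 _ (begin
        1 + L     ≤⟨ +-monoʳ-≤ 1 (m≤n*m L q {{>-nonZero q≥1}}) ⟩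
        1 + q * L ≡⟨ trans (+-comm 1 (q * L)) (sym hK) ⟩
        K         ≡⟨ blocks-avoiding z≢y ⟨
        count (λ J → N1 z J ∧ not (N1 y J)) + L ∎)
        where open ≤-Reasoning
    ... | J , e = J , ∧-not-true e

    -- Row z meets z ⊕ y in K − L > 2L blocks, but meets a ⊕ b in at most 2L.
    xor-rows-distinct : 3 ≤ q → ∀ {z y a b} → z ≢ y → z ≢ a → z ≢ b →
      ¬ (∀ J → (N1 z J xor N1 y J) ≡ (N1 a J xor N1 b J))
    xor-rows-distinct q≥3 {z} {y} {a} {b} z≢y z≢a z≢b same = <-irrefl refl (begin-strict
      3 * L                                               <⟨ s≤s (*-monoˡ-≤ L q≥3) ⟩
      suc (q * L)                                         ≡⟨ trans (+-comm 1 (q * L)) (sym hK) ⟩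
      K                                                   ≡⟨ blocks-avoiding z≢y ⟨
      count (λ J → N1 z J ∧ not (N1 y J)) + L
        ≡⟨ cong (_+ L) (count-cong (λ J → trans (∧-xor (N1 z J) (N1 y J)) (cong (N1 z J ∧_) (same J)))) ⟩
      count (λ J → N1 z J ∧ (N1 a J xor N1 b J)) + L
        ≤⟨ +-monoˡ-≤ L (count-≤-+ _ (λ J → N1 z J ∧ N1 a J) (λ J → N1 z J ∧ N1 b J)
                                    (λ J → bound (N1 z J) (N1 a J) (N1 b J))) ⟩
      (count (λ J → N1 z J ∧ N1 a J) + count (λ J → N1 z J ∧ N1 b J)) + L
                                                          ≡⟨ cong (_+ L) (cong₂ _+_ (pair-count z≢a) (pair-count z≢b)) ⟩
      (L + L) + L                                         ≡⟨ triple L ⟩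
      3 * L                                               ∎)
      where
      open ≤-Reasoning
      ∧-xor : ∀ z y → (z ∧ not y) ≡ (z ∧ (z xor y))
      ∧-xor true  y = refl
      ∧-xor false y = refl
      bound : ∀ z a b → χ (z ∧ (a xor b)) ≤ χ (z ∧ a) + χ (z ∧ b)
      bound true  true  true  = z≤n
      bound true  true  false = ≤-refl
      bound true  false true  = ≤-refl
      bound true  false false = z≤n
      bound false a     b     = z≤n
      triple : ∀ l → (l + l) + l ≡ 3 * l
      triple = solve-∀

    xor-rows-determine-pair : 3 ≤ q → ∀ {y y′ y₁ y₁′} → y ≢ y′ →
      (∀ J → (N1 y J xor N1 y′ J) ≡ (N1 y₁ J xor N1 y₁′ J)) → (y ≡ y₁ × y′ ≡ y₁′) ⊎ (y ≡ y₁′ × y′ ≡ y₁)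
    xor-rows-determine-pair q≥3 {y} {y′} {y₁} {y₁′} y≢y′ same
      with y Fin.≟ y₁ | y Fin.≟ y₁′ | y′ Fin.≟ y₁ | y′ Fin.≟ y₁′
    ... | yes refl | _        | _        | yes refl = inj₁ (refl , refl)
    ... | _        | yes refl | yes refl | _        = inj₂ (refl , refl)
    ... | no y≢y₁  | no y≢y₁′ | _        | _        = ⊥-elim (xor-rows-distinct q≥3 y≢y′ y≢y₁ y≢y₁′ same)
    ... | _        | _        | no y′≢y₁ | no y′≢y₁′ =
      ⊥-elim (xor-rows-distinct q≥3 (≢-sym y≢y′) y′≢y₁ y′≢y₁′ (λ J → trans (xor-comm (N1 y′ J) (N1 y J)) (same J)))
    ... | yes refl | _        | yes refl | _        = ⊥-elim (y≢y′ refl)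
    ... | _        | yes refl | _        | yes refl = ⊥-elim (y≢y′ refl)

-- The residual code

module _ (P : ℕ) .{{_ : NonZero P}} {v b} (N : Fin v → Fin b → Bool) where
  open Modulo P

  combination∈code : ∀ {r} (X : Fin b → ℕ) (rows : Fin r → Fin v) (β : Fin r → ℕ) →
    (∀ j → X j ≈ sumFin (λ k → β k * χ (N (rows k) j))) → InCode P N (λ j → X j % P)
  combination∈code X rows β X≈ = a , λ j → begin
    X j % P                                              ≡⟨ ≈⇒%≡ (X≈ j) ⟩
    sumFin (λ k → β k * χ (N (rows k) j)) % P            ≡⟨ cong (_% P) (collect j) ⟨
    sumFin (λ x → a x * χ (N x j)) % P                   ≡⟨ mod≡% _ P ⟨
    sumFin (λ x → a x * χ (N x j)) mod P                 ∎
    where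
    open ≡-Reasoning
    a : Fin v → ℕ
    a x = sumFin (λ k → χ (x ≡ᶠ rows k) * β k)
    collect : ∀ j → sumFin (λ x → a x * χ (N x j)) ≡ sumFin (λ k → β k * χ (N (rows k) j))
    collect j = begin
      sumFin (λ x → a x * χ (N x j))
        ≡⟨ sumFin-cong (λ x → sumFin-*ʳ (λ k → χ (x ≡ᶠ rows k) * β k) (χ (N x j))) ⟨
      sumFin (λ x → sumFin (λ k → χ (x ≡ᶠ rows k) * β k * χ (N x j)))
        ≡⟨ sumFin-swap (λ x k → χ (x ≡ᶠ rows k) * β k * χ (N x j)) ⟩
      sumFin (λ k → sumFin (λ x → χ (x ≡ᶠ rows k) * β k * χ (N x j)))
        ≡⟨ sumFin-cong (λ k → trans (sumFin-cong (λ x → *-assoc (χ (x ≡ᶠ rows k)) (β k) _))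
                                     (sumFin-indicator (rows k) (λ x → β k * χ (N x j)))) ⟩
      sumFin (λ k → β k * χ (N (rows k) j)) ∎

module Residual (P : ℕ) .{{_ : NonZero P}} {v b V} (N : Fin v → Fin b → Bool) (N1 : Fin V → Fin V → Bool) (B : Fin V)
  (σ : Fin v → Fin V) (τ : Fin b → Fin V) (σ-avoids-B : ∀ x → N1 (σ x) B ≡ false)
  (σ-onto : ∀ y → N1 y B ≡ false → ∃ λ x → σ x ≡ y)
  (τ-injective : Injective _≡_ _≡_ τ) (τ≢B : ∀ j → τ j ≢ B) (τ-onto : ∀ J → J ≢ B → ∃ λ j → τ j ≡ J)
  (incidence : ∀ x j → N x j ≡ N1 (σ x) (τ j))
  {K L q} (design : IsSymmetric2Design V K L N1) (hK : K ≡ q * L + 1) (hV : V ≡ q * K + 1)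
  .{{_ : NonZero (q * L)}} where
  open Modulo P
  open SymmetricDesign {q = q} N1 design hK hV

  -- c · (row y − row y′) of N1, read on the blocks of D; −c is represented by P ∸ c.
  diffWord : ℕ → Fin V → Fin V → Fin b → ℕ
  diffWord c y y′ j = (c * χ (N1 y (τ j)) + (P ∸ c) * χ (N1 y′ (τ j))) % P

  -- Rank N1 = rank N + 1 forces rows y, y′ of N1 to be dependent on the rows of N
  -- lifted through σ; column B shows that y and y′ enter with opposite coefficients.
  module RowDependence (isPrime : Prime P) {r} (rows : Fin r → Fin v) (independent : RowsIndependent P N rows)
    (rank₁-bound : ∀ (rows₁ : Fin (suc (suc r)) → Fin V) → ¬ RowsIndependent P N1 rows₁)
    {y y′} (yB : N1 y B ≡ true) (y′B : N1 y′ B ≡ true) where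

    rows₁ : Fin (suc (suc r)) → Fin V
    rows₁ zero          = y′
    rows₁ (suc zero)    = y
    rows₁ (suc (suc k)) = σ (rows k)

    dependence : ∃ (Dependence P N1 rows₁)
    dependence = ¬independent⇒dependence P N1 rows₁ (rank₁-bound rows₁)

    α : Fin (suc (suc r)) → ℕ
    α k = toℕ (proj₁ dependence k)

    α<P : ∀ k → α k < P
    α<P k = Fin.toℕ<n (proj₁ dependence k)

    rest : Fin b → ℕ
    rest j = sumFin (λ k → α (suc (suc k)) * χ (N (rows k) j))

    column-B : α zero + α (suc zero) ≈ 0
    column-B = ≈-trans (≡⇒≈ (sym entries)) (proj₁ (proj₂ dependence) B)
      where
      open ≡-Reasoning
      others : sumFin (λ k → α (suc (suc k)) * χ (N1 (σ (rows k)) B)) ≡ 0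
      others = trans (sumFin-cong (λ k → cong (λ x → α (suc (suc k)) * χ x) (σ-avoids-B (rows k))))
                     (trans (sumFin-cong (λ k → *-zeroʳ (α (suc (suc k))))) (sumFin-zero {r}))
      entries : sumFin (λ k → α k * χ (N1 (rows₁ k) B)) ≡ α zero + α (suc zero)
      entries = begin
        α zero * χ (N1 y′ B) + (α (suc zero) * χ (N1 y B) + sumFin (λ k → α (suc (suc k)) * χ (N1 (σ (rows k)) B)))
          ≡⟨ cong₂ (λ a₀ a₁ → a₀ + (a₁ + sumFin (λ k → α (suc (suc k)) * χ (N1 (σ (rows k)) B))))
                   (cong (λ x → α zero * χ x) y′B) (cong (λ x → α (suc zero) * χ x) yB) ⟩
        α zero * 1 + (α (suc zero) * 1 + sumFin (λ k → α (suc (suc k)) * χ (N1 (σ (rows k)) B)))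
          ≡⟨ cong₂ (λ a₀ a₁ → a₀ + a₁) (*-identityʳ (α zero)) (cong₂ _+_ (*-identityʳ (α (suc zero))) others) ⟩
        α zero + (α (suc zero) + 0)
          ≡⟨ cong (α zero +_) (+-identityʳ (α (suc zero))) ⟩
        α zero + α (suc zero) ∎

    column-τ : ∀ j → α zero * χ (N1 y′ (τ j)) + (α (suc zero) * χ (N1 y (τ j)) + rest j) ≈ 0
    column-τ j = ≈-trans (≡⇒≈ lifted) (proj₁ (proj₂ dependence) (τ j))
      where
      lifted : α zero * χ (N1 y′ (τ j)) + (α (suc zero) * χ (N1 y (τ j)) + rest j)
             ≡ sumFin (λ k → α k * χ (N1 (rows₁ k) (τ j)))
      lifted = cong (λ s → α zero * χ (N1 y′ (τ j)) + (α (suc zero) * χ (N1 y (τ j)) + s))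
                    (sumFin-cong (λ k → cong (λ x → α (suc (suc k)) * χ x) (incidence (rows k) j)))

    α₁≢0 : α (suc zero) ≢ 0
    α₁≢0 α₁≡0 = proj₂ (proj₂ (proj₂ dependence)) (all-zero (proj₁ (proj₂ (proj₂ dependence))))
      where
      α₀≡0 : α zero ≡ 0
      α₀≡0 = ≈0⇒≡0 (α<P zero) (≈-trans (≡⇒≈ (trans (sym (+-identityʳ (α zero))) (cong (α zero +_) (sym α₁≡0)))) column-B)
      rest≈0 : ∀ j → rest j ≈ 0
      rest≈0 j = ≈-trans
        (≡⇒≈ (sym (cong₂ (λ a₀ a₁ → a₀ * χ (N1 y′ (τ j)) + (a₁ * χ (N1 y (τ j)) + rest j)) α₀≡0 α₁≡0)))
                         (column-τ j)
      all-zero : ∀ k → α k ≡ 0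
      all-zero zero          = α₀≡0
      all-zero (suc zero)    = α₁≡0
      all-zero (suc (suc k)) = ≈0⇒≡0 (α<P (suc (suc k)))
        (mod≡0⇒≈0 (independent (λ k → α (suc (suc k))) (λ j → ≈0⇒mod≡0 (rest≈0 j)) k))

    inverse : ∃ λ e → e * α (suc zero) ≈ 1
    inverse = ≈-inverse isPrime (n≢0⇒n>0 α₁≢0) (α<P (suc zero))
    e : ℕ
    e = proj₁ inverse

    eα₀≈-1 : e * α zero ≈ (P ∸ 1) * 1
    eα₀≈-1 = ≈-negate (≈-trans (+-cong-≈ (≈-refl {e * α zero}) (≈-sym (proj₂ inverse)))
               (≈-trans (≡⇒≈ (sym (*-distribˡ-+ e (α zero) (α (suc zero)))))
                        (≈-trans (*-cong-≈ (≈-refl {e}) column-B) (≡⇒≈ (*-zeroʳ e)))))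

    difference+rest≈0 : ∀ {c} → c ≤ P → ∀ j →
      c * χ (N1 y (τ j)) + (P ∸ c) * χ (N1 y′ (τ j)) + c * e * rest j ≈ 0
    difference+rest≈0 {c} c≤P j = begin
      c * xu + (P ∸ c) * xw + c * e * S
        ≈⟨ +-cong-≈ (+-cong-≈ (≈-refl {c * xu}) (*-cong-≈ (P∸c≈-c c≤P) (≈-refl {xw}))) (≈-refl {c * e * S}) ⟩
      c * xu + (P ∸ 1) * c * xw + c * e * S
        ≡⟨ expand₁ c xu (P ∸ 1) xw (c * e * S) ⟩
      c * 1 * xu + (c * ((P ∸ 1) * 1) * xw + c * e * S)
        ≈⟨ +-cong-≈ (*-cong-≈ (*-cong-≈ (≈-refl {c}) (≈-sym (proj₂ inverse))) (≈-refl {xu}))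
                    (+-cong-≈ (*-cong-≈ (*-cong-≈ (≈-refl {c}) (≈-sym eα₀≈-1)) (≈-refl {xw})) (≈-refl {c * e * S})) ⟩
      c * (e * α (suc zero)) * xu + (c * (e * α zero) * xw + c * e * S)
        ≡⟨ expand₂ c e (α (suc zero)) xu (α zero) xw S ⟩
      c * e * (α zero * xw + (α (suc zero) * xu + S))
        ≈⟨ *-cong-≈ (≈-refl {c * e}) (column-τ j) ⟩
      c * e * 0
        ≡⟨ *-zeroʳ (c * e) ⟩
      0 ∎
      where
      open import Relation.Binary.Reasoning.Setoid ≈-setoid
      xu xw S : ℕ
      xu = χ (N1 y (τ j))
      xw = χ (N1 y′ (τ j))
      S = rest j
      expand₁ : ∀ c xu m xw ceS → c * xu + m * c * xw + ceS ≡ c * 1 * xu + (c * (m * 1) * xw + ceS)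
      expand₁ = solve-∀
      expand₂ : ∀ c e a₁ xu a₀ xw S → c * (e * a₁) * xu + (c * (e * a₀) * xw + c * e * S)
                                     ≡ c * e * (a₀ * xw + (a₁ * xu + S))
      expand₂ = solve-∀

    difference≈combination : ∀ {c} → c ≤ P → ∀ j →
      c * χ (N1 y (τ j)) + (P ∸ c) * χ (N1 y′ (τ j))
        ≈ sumFin (λ k → (P ∸ 1) * (c * e) * α (suc (suc k)) * χ (N (rows k) j))
    difference≈combination {c} c≤P j = begin
      c * χ (N1 y (τ j)) + (P ∸ c) * χ (N1 y′ (τ j))  ≈⟨ ≈-negate (difference+rest≈0 c≤P j) ⟩
      (P ∸ 1) * (c * e * rest j)                       ≡⟨ regroup (P ∸ 1) c e (rest j) ⟩
      m₀ * rest j                                      ≡⟨ sumFin-*ˡ m₀ (λ k → α (suc (suc k)) * χ (N (rows k) j)) ⟨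
      sumFin (λ k → m₀ * (α (suc (suc k)) * χ (N (rows k) j)))
                                                       ≡⟨ sumFin-cong (λ k → *-assoc m₀ (α (suc (suc k))) _) ⟨
      sumFin (λ k → m₀ * α (suc (suc k)) * χ (N (rows k) j)) ∎
      where
      open import Relation.Binary.Reasoning.Setoid ≈-setoid
      m₀ : ℕ
      m₀ = (P ∸ 1) * (c * e)
      regroup : ∀ m c e s → m * (c * e * s) ≡ m * (c * e) * s
      regroup = solve-∀

  diffWord∈code : Prime P → ∀ {r} → IsRankOver P N r → IsRankOver P N1 (suc r) →
    ∀ {c} → c ≤ P → ∀ {y y′} → N1 y B ≡ true → N1 y′ B ≡ true → InCode P N (diffWord c y y′)
  diffWord∈code isPrime ((rows , independent) , _) (_ , rank₁-bound) {c} c≤P {y} {y′} yB y′B =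
    combination∈code P N (λ j → c * χ (N1 y (τ j)) + (P ∸ c) * χ (N1 y′ (τ j)))
      rows (λ k → (P ∸ 1) * (c * e) * α (suc (suc k))) (difference≈combination c≤P)
    where open RowDependence isPrime rows independent rank₁-bound yB y′B

  module _ {y y′} (yB : N1 y B ≡ true) (y′B : N1 y′ B ≡ true) where

    xor-avoids-B : (N1 y B xor N1 y′ B) ≡ false
    xor-avoids-B = cong₂ _xor_ yB y′B

    xor-outside-B : ∀ {J} → (N1 y J xor N1 y′ J) ≡ true → ∃ λ j → τ j ≡ J
    xor-outside-B {J} e = τ-onto J (λ { refl → true≢false (trans (sym e) xor-avoids-B) })

    weight-diffWord : ∀ {c} → 1 ≤ c → c < P → weight (diffWord c y y′) ≡ count (λ J → N1 y J xor N1 y′ J)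
    weight-diffWord c≥1 c<P = trans (count-cong (λ j → residue-support c≥1 c<P (N1 y (τ j)) (N1 y′ (τ j))))
      (count-∘-injective τ τ-injective (λ J → N1 y J xor N1 y′ J) xor-outside-B)

  diffWord-value : ∀ {c} → c < P → ∀ {y y′ j} → N1 y (τ j) ≡ true → N1 y′ (τ j) ≡ false → diffWord c y y′ j ≡ c
  diffWord-value {c} c<P e e′ = begin
    (c * χ _ + (P ∸ c) * χ _) % P  ≡⟨ cong₂ (λ a a′ → (c * χ a + (P ∸ c) * χ a′) % P) e e′ ⟩
    (c * 1 + (P ∸ c) * 0) % P      ≡⟨ cong (_% P) (trans (cong₂ _+_ (*-identityʳ c) (*-zeroʳ (P ∸ c))) (+-identityʳ c)) ⟩
    c % P                          ≡⟨ m<n⇒m%n≡m c<P ⟩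
    c                              ∎
    where open ≡-Reasoning

  diffWord≗⇒xor≗ : ∀ {c c′} → 1 ≤ c → c < P → 1 ≤ c′ → c′ < P → ∀ {y y′ y₁ y₁′} →
    N1 y B ≡ true → N1 y′ B ≡ true → N1 y₁ B ≡ true → N1 y₁′ B ≡ true →
    (∀ j → diffWord c y y′ j ≡ diffWord c′ y₁ y₁′ j) → ∀ J → (N1 y J xor N1 y′ J) ≡ (N1 y₁ J xor N1 y₁′ J)
  diffWord≗⇒xor≗ {c} {c′} c≥1 c<P c′≥1 c′<P {y} {y′} {y₁} {y₁′} yB y′B y₁B y₁′B same J with J Fin.≟ B
  ... | yes refl = trans (xor-avoids-B yB y′B) (sym (xor-avoids-B y₁B y₁′B))
  ... | no J≢B with τ-onto J J≢B
  ...   | j , refl = begin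
    N1 y (τ j) xor N1 y′ (τ j)          ≡⟨ residue-support c≥1 c<P (N1 y (τ j)) (N1 y′ (τ j)) ⟨
    not (diffWord c y y′ j ≡ᵇ 0)        ≡⟨ cong (λ x → not (x ≡ᵇ 0)) (same j) ⟩
    not (diffWord c′ y₁ y₁′ j ≡ᵇ 0)     ≡⟨ residue-support c′≥1 c′<P (N1 y₁ (τ j)) (N1 y₁′ (τ j)) ⟩
    N1 y₁ (τ j) xor N1 y₁′ (τ j)        ∎
    where open ≡-Reasoning

  diffWord-injectiveˡ : 1 ≤ q → ∀ {c c′} → c < P → c′ < P → ∀ {y y′} → N1 y′ B ≡ true → y ≢ y′ →
    (∀ j → diffWord c y y′ j ≡ diffWord c′ y y′ j) → c ≡ c′
  diffWord-injectiveˡ q≥1 c<P c′<P y′B y≢y′ same with separating-block q≥1 y≢y′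
  ... | J , yJ , y′J with τ-onto J (λ { refl → true≢false (trans (sym y′B) y′J) })
  ...   | j , refl = trans (sym (diffWord-value c<P yJ y′J)) (trans (same j) (diffWord-value c′<P yJ y′J))

  module _ {m} (cl : Fin b → Fin m) (resolution : IsAffineResolution N cl) where

    parallel-disjoint : ∀ {j j′} → cl j ≡ cl j′ → j ≢ j′ → ∀ x → (N x j ∧ N x j′) ≡ false
    parallel-disjoint {j} {j′} same j≢j′ x with N x j in xj | N x j′ in xj′
    ... | false | _     = refl
    ... | true  | false = refl
    ... | true  | true  = ⊥-elim (j≢j′ (count≡1⇒unique (λ k → N x k ∧ (cl k ≡ᶠ cl j)) (proj₁ resolution (cl j) x)
          (cong₂ _∧_ xj (≡ᶠ-refl (cl j))) (cong₂ _∧_ xj′ (trans (cong (_≡ᶠ cl j) (sym same)) (≡ᶠ-refl (cl j))))))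

    -- Parallel blocks are disjoint off B, so τ j ∩ τ j′ ⊆ B; both it and B ∩ τ j have L points.
    parallel-trace-⊆ : ∀ {j j′} → cl j ≡ cl j′ → j ≢ j′ →
      ∀ {y} → N1 y B ≡ true → N1 y (τ j) ≡ true → N1 y (τ j′) ≡ true
    parallel-trace-⊆ {j} {j′} same j≢j′ yB yj =
      count-∧≡count⇒⊆ (λ y → N1 y B ∧ N1 y (τ j)) (λ y → N1 y (τ j′)) counts (cong₂ _∧_ yB yj)
      where
      open ≡-Reasoning
      outside : ∀ y → N1 y B ≡ false → (N1 y (τ j) ∧ N1 y (τ j′)) ≡ false
      outside y yB with σ-onto y yB
      ... | x , refl = trans (sym (cong₂ _∧_ (incidence x j) (incidence x j′))) (parallel-disjoint same j≢j′ x)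
      outside′ : ∀ y → ((N1 y (τ j) ∧ N1 y (τ j′)) ∧ not (N1 y B)) ≡ false
      outside′ y with N1 y B in yB
      ... | true  = ∧-zeroʳ _
      ... | false = trans (∧-identityʳ _) (outside y yB)
      counts : count (λ y → (N1 y B ∧ N1 y (τ j)) ∧ N1 y (τ j′)) ≡ count (λ y → N1 y B ∧ N1 y (τ j))
      counts = begin
        count (λ y → (N1 y B ∧ N1 y (τ j)) ∧ N1 y (τ j′))
          ≡⟨ count-cong (λ y → trans (∧-assoc (N1 y B) _ _) (sym (∧-comm (N1 y (τ j) ∧ N1 y (τ j′)) (N1 y B)))) ⟩
        count (λ y → (N1 y (τ j) ∧ N1 y (τ j′)) ∧ N1 y B)
          ≡⟨ +-identityʳ _ ⟨
        count (λ y → (N1 y (τ j) ∧ N1 y (τ j′)) ∧ N1 y B) + 0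
          ≡⟨ cong₂ _+_ refl (count-false _ outside′) ⟨
        count (λ y → (N1 y (τ j) ∧ N1 y (τ j′)) ∧ N1 y B) + count (λ y → (N1 y (τ j) ∧ N1 y (τ j′)) ∧ not (N1 y B))
          ≡⟨ count-split (λ y → N1 y (τ j) ∧ N1 y (τ j′)) (λ y → N1 y B) ⟨
        count (λ y → N1 y (τ j) ∧ N1 y (τ j′))
          ≡⟨ blocks-meet (λ e → j≢j′ (sym (τ-injective e))) ⟩
        L
          ≡⟨ blocks-meet (τ≢B j) ⟨
        count (λ y → N1 y B ∧ N1 y (τ j)) ∎

    parallel⇒same-trace : ∀ {j j′} → cl j ≡ cl j′ → ∀ {y} → N1 y B ≡ true → N1 y (τ j) ≡ N1 y (τ j′)
    parallel⇒same-trace {j} {j′} same yB with j Fin.≟ j′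
    ... | yes refl = refl
    ... | no j≢j′  = ⇔→≡ (mk⇔ (parallel-trace-⊆ same j≢j′ yB) (parallel-trace-⊆ (sym same) (≢-sym j≢j′) yB))

    diffWord-union : ∀ c {y y′} → N1 y B ≡ true → N1 y′ B ≡ true → SupportUnionOfClasses cl (diffWord c y y′)
    diffWord-union c yB y′B j j′ same =
      subst (_≡ 0) (cong₂ (λ a a′ → (c * χ a + (P ∸ c) * χ a′) % P)
                          (parallel⇒same-trace same yB) (parallel⇒same-trace same y′B))

  module Family {E} (π : Fin E → Fin V) (π-injective : Injective _≡_ _≡_ π) (π-on-B : ∀ x → N1 (π x) B ≡ true) where

    -- An index encodes a coefficient in {1, …, P − 1} and a 2-subset of the points of B.
    Index : Set
    Index = Fin ((P ∸ 1) * (E C 2))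

    coefficient-index : Index → Fin (P ∸ 1)
    coefficient-index = quotient (E C 2)

    pair-index : Index → Fin (E C 2)
    pair-index = remainder {P ∸ 1} (E C 2)

    coefficient : Index → ℕ
    coefficient i = suc (toℕ (coefficient-index i))

    pair : Index → Fin E × Fin E
    pair i = choose2 E (pair-index i)

    word : Index → Fin b → ℕ
    word i = diffWord (coefficient i) (π (proj₁ (pair i))) (π (proj₂ (pair i)))

    coefficient<P : ∀ i → coefficient i < P
    coefficient<P i = subst₂ _<_ (+-comm (toℕ (coefficient-index i)) 1) P∸1+1 (+-monoˡ-< 1 (Fin.toℕ<n (coefficient-index i)))

    pair-distinct : ∀ i → π (proj₁ (pair i)) ≢ π (proj₂ (pair i))
    pair-distinct i e = <-irrefl (cong toℕ (π-injective e)) (choose2-< E _)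

    word-injective : 3 ≤ q → ∀ {i i′} → (∀ j → word i j ≡ word i′ j) → i ≡ i′
    word-injective q≥3 {i} {i′} same
      with xor-rows-determine-pair q≥3 (pair-distinct i)
             (diffWord≗⇒xor≗ (s≤s z≤n) (coefficient<P i) (s≤s z≤n) (coefficient<P i′)
                             (π-on-B _) (π-on-B _) (π-on-B _) (π-on-B _) same)
    ... | inj₂ (u≡w′ , w≡u′) = ⊥-elim (<-asym (choose2-< E (pair-index i))
            (subst₂ (λ a a′ → toℕ a < toℕ a′) (sym (π-injective w≡u′)) (sym (π-injective u≡w′))
                    (choose2-< E (pair-index i′))))
    ... | inj₁ (u≡u′ , w≡w′) = begin
      i                                                        ≡⟨ Fin.combine-remQuot {P ∸ 1} (E C 2) i ⟨
      combine (coefficient-index i) (pair-index i)             ≡⟨ cong₂ combine coefficient-index≡ pair-index≡ ⟩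
      combine (coefficient-index i′) (pair-index i′)           ≡⟨ Fin.combine-remQuot {P ∸ 1} (E C 2) i′ ⟩
      i′                                                       ∎
      where
      open ≡-Reasoning
      pair-index≡ : pair-index i ≡ pair-index i′
      pair-index≡ = choose2-injective E (cong₂ _,_ (π-injective u≡u′) (π-injective w≡w′))
      same-points : ∀ j → word i j ≡ diffWord (coefficient i′) (π (proj₁ (pair i))) (π (proj₂ (pair i))) j
      same-points j = trans (same j) (sym (cong₂ (λ y y′ → diffWord (coefficient i′) y y′ j) u≡u′ w≡w′))
      coefficient-index≡ : coefficient-index i ≡ coefficient-index i′
      coefficient-index≡ = Fin.toℕ-injective (suc-injective
        (diffWord-injectiveˡ (≤-trans (s≤s z≤n) q≥3) (coefficient<P i) (coefficient<P i′) (π-on-B _) (pair-distinct i) same-points))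

    words-distinct : 3 ≤ q → ∀ i i′ → i ≢ i′ → ∃ λ j → word i j ≢ word i′ j
    words-distinct q≥3 i i′ i≢i′ =
      Fin.¬∀⟶∃¬ b _ (λ j → word i j ≟ word i′ j) (λ same → i≢i′ (word-injective q≥3 same))

    word∈code : Prime P → ∀ {r} → IsRankOver P N r → IsRankOver P N1 (suc r) → ∀ i → InCode P N (word i)
    word∈code isPrime rank rank₁ i = diffWord∈code isPrime rank rank₁ (<⇒≤ (coefficient<P i)) (π-on-B _) (π-on-B _)

    word-weight : ∀ {W} → K ≡ W + L → ∀ i → weight (word i) ≡ 2 * W
    word-weight K≡W+L i = trans (weight-diffWord (π-on-B _) (π-on-B _) (s≤s z≤n) (coefficient<P i))
                                (symmetric-difference-size K≡W+L (pair-distinct i))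

    word-union : ∀ {m} (cl : Fin b → Fin m) → IsAffineResolution N cl → ∀ i → SupportUnionOfClasses cl (word i)
    word-union cl resolution i = diffWord-union cl resolution (coefficient i) (π-on-B _) (π-on-B _)

theorem5p5 : (p t n : ℕ) → Prime p → 4 ≤ p ^ t → 2 ≤ n →
    (b : ℕ) (N : Fin ((p ^ t) ^ n) → Fin b → Bool) →
    Is2Design ((p ^ t) ^ n) b ((p ^ t) ^ (n ∸ 1)) (θ (p ^ t) (n ∸ 1)) N →
    (m : ℕ) (c : Fin b → Fin m) → IsAffineResolution N c →
    (Σ (Fin (θ (p ^ t) (suc n)) → Fin (θ (p ^ t) (suc n)) → Bool) λ N1 →
      IsSymmetric2Design (θ (p ^ t) (suc n)) (θ (p ^ t) n) (θ (p ^ t) (n ∸ 1)) N1 ×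
      Σ (Fin (θ (p ^ t) (suc n))) λ B →
        IsNormalBlock (p ^ t) n N1 B × LinEmbeddableResidual p N N1 B) →
    Σ (Fin ((p ∸ 1) * (θ (p ^ t) n C 2)) → Fin b → ℕ) λ ws →
      (∀ i i' → i ≢ i' → ∃ λ j → ws i j ≢ ws i' j) ×
      (∀ i → InCode p N (ws i) × weight (ws i) ≡ 2 * (p ^ t) ^ (n ∸ 1) ×
             SupportUnionOfClasses c (ws i))
theorem5p5 p t 0 _ _ ()
theorem5p5 p t 1 _ _ (s≤s ())
theorem5p5 p t (suc (suc n)) p-prime q≥4 _ _ N _ _ cl resolution
  (N1 , design , B , (_ , _ , π , _ , π-injective , π-on-B , _) ,
   ((σ , τ , _ , σ-avoids-B , σ-onto , τ-injective , τ≢B , τ-onto , incidence) , _ , rank , rank₁)) =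
  word , words-distinct q≥3 ,
  λ i → word∈code p-prime rank rank₁ i , word-weight (θ-suc-^ (suc n) q≥2) i , word-union cl resolution i
  where
  q : ℕ
  q = p ^ t
  q≥2 : 2 ≤ q
  q≥2 = ≤-trans (s≤s (s≤s z≤n)) q≥4
  q≥3 : 3 ≤ q
  q≥3 = ≤-trans (s≤s (s≤s (s≤s z≤n))) q≥4
  L≥1 : 1 ≤ θ q (suc n)
  L≥1 = ≤-trans (m≤n+m 1 _) (≤-reflexive (sym (θ-suc n q≥2)))
  instance
    p≢0 : NonZero p
    p≢0 = prime⇒nonZero p-prime
    qL≢0 : NonZero (q * θ q (suc n))
    qL≢0 = >-nonZero (*-mono-≤ (≤-trans (s≤s z≤n) q≥2) L≥1)
  open Residual p N N1 B σ τ σ-avoids-B σ-onto τ-injective τ≢B τ-onto incidence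
         {q = q} design (θ-suc (suc n) q≥2) (θ-suc (suc (suc n)) q≥2)
  open Family π π-injective π-on-B
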